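{- Let $M$ be a delta-matroid over a finite ground set $V$ that is $\mathrm{inv}$-representable over $GF(4)$. Then for every finite sequence $\varphi$ of operations, each of the form $*u$ (pivot) or $+u$ (loop complementation) with $u\in V$, the set system $M\varphi$ is again a delta-matroid that is $\mathrm{inv}$-representable over $GF(4)$.
   Context: A set system over $V$ is a pair $M=(V,E)$ with $E\subseteq 2^V$; write $Y\in M$ for $Y\in E$. Pivot (twist): for $X\subseteq V$, $M*X=(V,\{Y\triangle X\mid Y\in E\})$; $M*u=M*\{u\}$. Loop complementation: for $u\in V$, $M+u=(V,E')$ with $E'=E\triangle\{Y\cup\{u\}\mid Y\in E,\ u\notin Y\}$. Operations are applied left to right. A delta-matroid is a set system with $E\neq\emptyset$ satisfying the symmetric exchange axiom: for all $X,Y\in M$ and $u\in X\triangle Y$, either $X\triangle\{u\}\in M$ or there is $v\in X\triangle Y$, $v\neq u$, with $X\triangle\{u,v\}\in M$. For a $V\times V$-matrix $A$, $\mathcal{M}_A=(V,\{X\subseteq V\mid A[X]\text{ nonsingular}\})$, where $A[X]$ is the principal submatrix on $X$ and the empty matrix is nonsingular. $\mathrm{inv}$ is the nontrivial automorphism $x\mapsto x^2$ of $GF(4)$, applied entrywise; a matrix $A$ over $GF(4)$ is $\mathrm{inv}$-symmetric if $\mathrm{inv}(-A^T)=A$. A delta-matroid $M$ is $\mathrm{inv}$-representable over $GF(4)$ if $M=\mathcal{M}_A*X$ for some $\mathrm{inv}$-symmetric $V\times V$-matrix $A$ over $GF(4)$ and some $X\subseteq V$. -}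

module Defs where

open import Data.Nat using (ℕ; zero; suc)
open import Data.Bool using (Bool; true; false; not; _∧_; _xor_)
open import Data.Fin using (Fin; zero; suc; punchIn)
open import Data.Fin.Subset using (Subset; ⁅_⁆; _∪_)
open import Data.Vec using (Vec; []; _∷_; lookup; zipWith; _[_]≔_)
open import Data.List using (List; []; _∷_; length; foldl)
import Data.List as L
open import Data.Product using (Σ; ∃; _×_; _,_)
open import Data.Sum using (_⊎_)
open import Relation.Binary.PropositionalEquality using (_≡_; _≢_)

-- The field GF(4) = {0, 1, ω, ω²}, with ω² = ω + 1.

data GF4 : Set where
  𝟎 𝟏 ω ω² : GF4

_+F_ : GF4 → GF4 → GF4
𝟎  +F y  = y
x  +F 𝟎  = x
𝟏  +F 𝟏  = 𝟎
𝟏  +F ω  = ω²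
𝟏  +F ω² = ω
ω  +F 𝟏  = ω²
ω  +F ω  = 𝟎
ω  +F ω² = 𝟏
ω² +F 𝟏  = ω
ω² +F ω  = 𝟏
ω² +F ω² = 𝟎

_*F_ : GF4 → GF4 → GF4
𝟎  *F y  = 𝟎
x  *F 𝟎  = 𝟎
𝟏  *F y  = y
x  *F 𝟏  = x
ω  *F ω  = ω²
ω  *F ω² = 𝟏
ω² *F ω  = 𝟏
ω² *F ω² = ω

-F_ : GF4 → GF4
-F x = x

-- the nontrivial field automorphism x ↦ x²
inv : GF4 → GF4
inv 𝟎  = 𝟎
inv 𝟏  = 𝟏
inv ω  = ω²
inv ω² = ω

isZero : GF4 → Bool
isZero 𝟎 = true
isZero _ = false

Mat : ℕ → Set
Mat n = Fin n → Fin n → GF4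

sumF : ∀ {k} → (Fin k → GF4) → GF4
sumF {zero}  f = 𝟎
sumF {suc k} f = f zero +F sumF (λ i → f (suc i))

sign : ∀ {k} → Fin k → GF4 → GF4
sign zero    x = x
sign (suc j) x = -F (sign j x)

det : ∀ {k} → Mat k → GF4
det {zero}  A = 𝟏
det {suc k} A =
  sumF (λ j → sign j (A zero j *F det (λ i l → A (suc i) (punchIn j l))))

elems : ∀ {n} → Subset n → List (Fin n)
elems {zero}  []          = []
elems {suc n} (true ∷ p)  = zero ∷ L.map suc (elems p)
elems {suc n} (false ∷ p) = L.map suc (elems p)

principal : ∀ {n} → Mat n → (X : Subset n) → Mat (length (elems X))
principal A X i j = A (L.lookup (elems X) i) (L.lookup (elems X) j)

nonsingular : ∀ {k} → Mat k → Bool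
nonsingular A = not (isZero (det A))

SetSystem : ℕ → Set
SetSystem n = Subset n → Bool

_∈ₛ_ : ∀ {n} → Subset n → SetSystem n → Set
Y ∈ₛ M = M Y ≡ true

_△_ : ∀ {n} → Subset n → Subset n → Subset n
X △ Y = zipWith _xor_ X Y

-- pivot (twist): M * X = {Y △ X | Y ∈ M};  Z ∈ M*X  iff  Z △ X ∈ M
_⋆_ : ∀ {n} → SetSystem n → Subset n → SetSystem n
(M ⋆ X) Z = M (Z △ X)

-- loop complementation: E' = E △ {Y ∪ {u} | Y ∈ E, u ∉ Y};
-- Z ∈ {Y ∪ {u} | Y ∈ E, u ∉ Y}  iff  u ∈ Z and Z - {u} ∈ E
_⊕_ : ∀ {n} → SetSystem n → Fin n → SetSystem n
(M ⊕ u) Z = M Z xor (lookup Z u ∧ M (Z [ u ]≔ false))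

-- operations *u and +u, applied left to right
data Op (n : ℕ) : Set where
  piv  : Fin n → Op n
  loop : Fin n → Op n

applyOp : ∀ {n} → SetSystem n → Op n → SetSystem n
applyOp M (piv u)  = M ⋆ ⁅ u ⁆
applyOp M (loop u) = M ⊕ u

applySeq : ∀ {n} → SetSystem n → List (Op n) → SetSystem n
applySeq = foldl applyOp

IsDeltaMatroid : ∀ {n} → SetSystem n → Set
IsDeltaMatroid {n} M =
  (∃ λ Y → Y ∈ₛ M) ×
  (∀ X Y → X ∈ₛ M → Y ∈ₛ M → ∀ (u : Fin n) → lookup (X △ Y) u ≡ true →
     ((X △ ⁅ u ⁆) ∈ₛ M) ⊎
     (∃ λ (v : Fin n) → lookup (X △ Y) v ≡ true × v ≢ u ×
        ((X △ (⁅ u ⁆ ∪ ⁅ v ⁆)) ∈ₛ M)))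

matrixSystem : ∀ {n} → Mat n → SetSystem n
matrixSystem A X = nonsingular (principal A X)

InvSymmetric : ∀ {n} → Mat n → Set
InvSymmetric A = ∀ i j → inv (-F (A j i)) ≡ A i j

InvRepresentable : ∀ {n} → SetSystem n → Set
InvRepresentable {n} M =
  Σ (Mat n) λ A → InvSymmetric A × Σ (Subset n) λ X →
    ∀ Y → M Y ≡ (matrixSystem A ⋆ X) Y

-- Principal minors of an inv-symmetric matrix A over GF(4) lie in GF(2)
-- (induction through Schur complements).  Since a determinant is affine in a
-- diagonal entry, adding 1 to A u u adds det A[Y - u] to det A[Y] for u ∈ Y,
-- so it realises loop complementation +u on M_A; and when A u u = 1 the twist
-- *u on M_A is realised by the principal pivot at u.  For a representation
-- M_A * X, the twist by X commutes with +u when u ∉ X, and the case u ∈ X is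
-- reduced to these two through the relation +u*u+u = *u+u*u.  Finally, a
-- representation M_A * X is a delta-matroid: twisting by a feasible set,
-- removing one element with diagonal entry 1 or one nonsingular 2×2 block at a
-- time, produces some M_D, whose exchange axiom at ∅ holds because no row of a
-- nonsingular principal submatrix vanishes.

module Submission where

open import Defs
open import Data.Bool using (Bool; true; false; not; _∧_; _∨_; _xor_; if_then_else_)
open import Data.Bool.Properties using (∧-zeroʳ; ∨-zeroʳ)
import Data.Bool.Properties as Bool
open import Data.Empty using (⊥-elim)
open import Data.Fin using (Fin; zero; suc; punchIn; punchOut; _≟_; cast)
open import Data.Fin.Properties using (any?; punchInᵢ≢i; punchIn-punchOut; punchOut-cong; punchOut-punchIn; cast-is-id)
open import Data.Fin.Subset using (Subset; ⁅_⁆; _∪_; ⊥; ∣_∣)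
open import Data.Fin.Subset.Properties using (∪-identityˡ; ∪-identityʳ; Empty-unique)
open import Data.List using (List; []; _∷_; length; map)
import Data.List as L
open import Data.List.Membership.Propositional.Properties using (∈-lookup)
import Data.List.Relation.Unary.All as All
open import Data.List.Relation.Unary.All using (All; []; _∷_)
open import Data.List.Relation.Unary.All.Properties using (map⁺)
open import Data.Nat using (ℕ; zero; suc; _≤_; _<_; s≤s; s≤s⁻¹)
open import Data.Nat.Properties using (≤-trans; <-≤-trans; n≤1+n; n≮0; ≤-refl)
open import Data.Product using (Σ; ∃; _×_; _,_; proj₁; proj₂)
open import Data.Sum using (_⊎_; inj₁; inj₂)
import Data.Sum as Sum
open import Data.Vec using ([]; _∷_; lookup; _[_]≔_)
open import Data.Vec.Properties
  using ([]=⇒lookup; lookup-replicate; lookup-zipWith; zipWith-assoc; zipWith-comm; zipWith-identityˡ;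
         zipWith-identityʳ; lookup∘update; lookup∘update′; []≔-idempotent; []≔-lookup)
import Data.Vec.Functional as V
open import Data.Vec.Functional.Properties using (insertAt-lookup; insertAt-punchIn)
open import Function using (_∘_)
open import Relation.Binary.PropositionalEquality
import Relation.Binary.Reasoning.Setoid as SetoidReasoning
open import Relation.Nullary using (Dec; yes; no; does; contradiction)
open import Relation.Nullary.Decidable using (from-yes; _×-dec_; _→-dec_; ¬?; map′; dec-true; dec-false)

infix 4 _≟F_
_≟F_ : (x y : GF4) → Dec (x ≡ y)
𝟎  ≟F 𝟎  = yes refl
𝟏  ≟F 𝟏  = yes refl
ω  ≟F ω  = yes refl
ω² ≟F ω² = yes refl
𝟎  ≟F 𝟏  = no λ ()
𝟎  ≟F ω  = no λ ()
𝟎  ≟F ω² = no λ ()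
𝟏  ≟F 𝟎  = no λ ()
𝟏  ≟F ω  = no λ ()
𝟏  ≟F ω² = no λ ()
ω  ≟F 𝟎  = no λ ()
ω  ≟F 𝟏  = no λ ()
ω  ≟F ω² = no λ ()
ω² ≟F 𝟎  = no λ ()
ω² ≟F 𝟏  = no λ ()
ω² ≟F ω  = no λ ()

every? : {P : GF4 → Set} → (∀ x → Dec (P x)) → Dec (∀ x → P x)
every? P? = map′ (λ { (a , b , c , d) → λ { 𝟎 → a ; 𝟏 → b ; ω → c ; ω² → d } })
                 (λ h → h 𝟎 , h 𝟏 , h ω , h ω²)
                 (P? 𝟎 ×-dec P? 𝟏 ×-dec P? ω ×-dec P? ω²)

+-comm : ∀ x y → x +F y ≡ y +F x
+-comm = from-yes (every? λ x → every? λ y → x +F y ≟F y +F x)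

+-assoc : ∀ x y z → (x +F y) +F z ≡ x +F (y +F z)
+-assoc = from-yes (every? λ x → every? λ y → every? λ z → (x +F y) +F z ≟F x +F (y +F z))

+-interchange : ∀ w x y z → (w +F x) +F (y +F z) ≡ (w +F y) +F (x +F z)
+-interchange = from-yes (every? λ w → every? λ x → every? λ y → every? λ z →
  (w +F x) +F (y +F z) ≟F (w +F y) +F (x +F z))

+-identityʳ : ∀ x → x +F 𝟎 ≡ x
+-identityʳ = from-yes (every? λ x → x +F 𝟎 ≟F x)

x+x≡0 : ∀ x → x +F x ≡ 𝟎
x+x≡0 = from-yes (every? λ x → x +F x ≟F 𝟎)

x+y+y≡x : ∀ x y → (x +F y) +F y ≡ x
x+y+y≡x = from-yes (every? λ x → every? λ y → (x +F y) +F y ≟F x)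

*-comm : ∀ x y → x *F y ≡ y *F x
*-comm = from-yes (every? λ x → every? λ y → x *F y ≟F y *F x)

*-assoc : ∀ x y z → (x *F y) *F z ≡ x *F (y *F z)
*-assoc = from-yes (every? λ x → every? λ y → every? λ z → (x *F y) *F z ≟F x *F (y *F z))

*-rotate : ∀ x y z → x *F (y *F z) ≡ y *F (x *F z)
*-rotate = from-yes (every? λ x → every? λ y → every? λ z → x *F (y *F z) ≟F y *F (x *F z))

*-identityˡ : ∀ x → 𝟏 *F x ≡ x
*-identityˡ = from-yes (every? λ x → 𝟏 *F x ≟F x)

*-zeroʳ : ∀ x → x *F 𝟎 ≡ 𝟎
*-zeroʳ = from-yes (every? λ x → x *F 𝟎 ≟F 𝟎)

*-distribˡ-+ : ∀ x y z → x *F (y +F z) ≡ (x *F y) +F (x *F z)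
*-distribˡ-+ = from-yes (every? λ x → every? λ y → every? λ z → x *F (y +F z) ≟F (x *F y) +F (x *F z))

*-distribʳ-+ : ∀ x y z → (y +F z) *F x ≡ (y *F x) +F (z *F x)
*-distribʳ-+ = from-yes (every? λ x → every? λ y → every? λ z → (y +F z) *F x ≟F (y *F x) +F (z *F x))

x*invx≡1 : ∀ x → x ≢ 𝟎 → x *F inv x ≡ 𝟏
x*invx≡1 = from-yes (every? λ x → ¬? (x ≟F 𝟎) →-dec (x *F inv x ≟F 𝟏))

inv-+ : ∀ x y → inv (x +F y) ≡ inv x +F inv y
inv-+ = from-yes (every? λ x → every? λ y → inv (x +F y) ≟F inv x +F inv y)

inv-+-* : ∀ x y z → inv (x +F (y *F z)) ≡ inv x +F (inv z *F inv y)
inv-+-* = from-yes (every? λ x → every? λ y → every? λ z → inv (x +F (y *F z)) ≟F inv x +F (inv z *F inv y))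

-- x lies in the prime field GF(2) = {0, 1}, the fixed field of inv.
Binary : GF4 → Set
Binary x = inv x ≡ x

binary⇒0⊎1 : ∀ x → Binary x → x ≡ 𝟎 ⊎ x ≡ 𝟏
binary⇒0⊎1 𝟎 _ = inj₁ refl
binary⇒0⊎1 𝟏 _ = inj₂ refl
binary⇒0⊎1 ω  ()
binary⇒0⊎1 ω² ()

binary-+ : ∀ {x y} → Binary x → Binary y → Binary (x +F y)
binary-+ {x} {y} bx by = trans (inv-+ x y) (cong₂ _+F_ bx by)

nonzero : GF4 → Bool
nonzero x = not (isZero x)

nonzero-+ : ∀ x y → Binary x → Binary y → nonzero (x +F y) ≡ nonzero x xor nonzero y
nonzero-+ = from-yes (every? λ x → every? λ y → (inv x ≟F x) →-dec (inv y ≟F y) →-dec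
  (nonzero (x +F y) Bool.≟ nonzero x xor nonzero y))

sumF-cong : ∀ {k} {f g : Fin k → GF4} → (∀ i → f i ≡ g i) → sumF f ≡ sumF g
sumF-cong {zero}  f≗g = refl
sumF-cong {suc k} f≗g = cong₂ _+F_ (f≗g zero) (sumF-cong (f≗g ∘ suc))

sumF-zero : ∀ {k} (f : Fin k → GF4) → (∀ i → f i ≡ 𝟎) → sumF f ≡ 𝟎
sumF-zero {zero}  f f≗0 = refl
sumF-zero {suc k} f f≗0 = cong₂ _+F_ (f≗0 zero) (sumF-zero (f ∘ suc) (f≗0 ∘ suc))

sumF-+ : ∀ {k} (f g : Fin k → GF4) → sumF (λ i → f i +F g i) ≡ sumF f +F sumF g
sumF-+ {zero}  f g = refl
sumF-+ {suc k} f g = trans (cong ((f zero +F g zero) +F_) (sumF-+ (f ∘ suc) (g ∘ suc)))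
                           (+-interchange (f zero) (g zero) _ _)

sumF-*ˡ : ∀ {k} c (f : Fin k → GF4) → sumF (λ i → c *F f i) ≡ c *F sumF f
sumF-*ˡ {zero}  c f = sym (*-zeroʳ c)
sumF-*ˡ {suc k} c f = trans (cong ((c *F f zero) +F_) (sumF-*ˡ c (f ∘ suc)))
                            (sym (*-distribˡ-+ c _ _))

sumF-swap : ∀ {k m} (G : Fin k → Fin m → GF4) →
  sumF (λ a → sumF (G a)) ≡ sumF (λ b → sumF (λ a → G a b))
sumF-swap {zero} {m} G = sym (sumF-zero {m} (λ _ → 𝟎) (λ _ → refl))
sumF-swap {suc k} G = trans (cong (sumF (G zero) +F_) (sumF-swap (G ∘ suc)))
                            (sym (sumF-+ (G zero) _))

sumF-punchIn : ∀ {k} (a : Fin (suc k)) (f : Fin (suc k) → GF4) →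
  sumF f ≡ f a +F sumF (f ∘ punchIn a)
sumF-punchIn zero          f = refl
sumF-punchIn {suc k} (suc a) f = begin
  f zero +F sumF (f ∘ suc)                            ≡⟨ cong (f zero +F_) (sumF-punchIn a (f ∘ suc)) ⟩
  f zero +F (f (suc a) +F rest)                       ≡⟨ sym (+-assoc (f zero) _ _) ⟩
  (f zero +F f (suc a)) +F rest                       ≡⟨ cong (_+F rest) (+-comm (f zero) _) ⟩
  (f (suc a) +F f zero) +F rest                       ≡⟨ +-assoc (f (suc a)) _ _ ⟩
  f (suc a) +F (f zero +F rest)                       ∎
  where
  open ≡-Reasoning
  rest = sumF (f ∘ suc ∘ punchIn a)

sumF-punchIn′ : ∀ {k} (a : Fin (suc k)) (f : Fin (suc k) → GF4) →
  sumF (f ∘ punchIn a) ≡ sumF f +F f a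
sumF-punchIn′ a f = begin
  sumF (f ∘ punchIn a)                   ≡⟨ sym (x+y+y≡x _ (f a)) ⟩
  (sumF (f ∘ punchIn a) +F f a) +F f a   ≡⟨ cong (_+F f a) (+-comm _ (f a)) ⟩
  (f a +F sumF (f ∘ punchIn a)) +F f a   ≡⟨ cong (_+F f a) (sym (sumF-punchIn a f)) ⟩
  sumF f +F f a                          ∎
  where open ≡-Reasoning

-- The sum over ordered pairs a ≠ b, indexed from either coordinate.
sumF-offDiagonal-swap : ∀ {m} (G : Fin (suc m) → Fin (suc m) → GF4) →
  sumF (λ a → sumF (λ l → G a (punchIn a l))) ≡ sumF (λ b → sumF (λ l → G (punchIn b l) b))
sumF-offDiagonal-swap G = begin
  sumF (λ a → sumF (λ l → G a (punchIn a l)))      ≡⟨ sumF-cong (λ a → sumF-punchIn′ a (G a)) ⟩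
  sumF (λ a → sumF (G a) +F G a a)                 ≡⟨ sumF-+ (λ a → sumF (G a)) (λ a → G a a) ⟩
  sumF (λ a → sumF (G a)) +F diagonal              ≡⟨ cong (_+F diagonal) (sumF-swap G) ⟩
  sumF (λ b → sumF (λ a → G a b)) +F diagonal      ≡⟨ sym (sumF-+ (λ b → sumF (λ a → G a b)) (λ a → G a a)) ⟩
  sumF (λ b → sumF (λ a → G a b) +F G b b)         ≡⟨ sym (sumF-cong (λ b → sumF-punchIn′ b (λ a → G a b))) ⟩
  sumF (λ b → sumF (λ l → G (punchIn b l) b))      ∎
  where
  open ≡-Reasoning
  diagonal = sumF (λ a → G a a)

minor : ∀ {k} → Fin (suc k) → Fin (suc k) → Mat (suc k) → Mat k
minor p q A i j = A (punchIn p i) (punchIn q j)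

det-cong : ∀ {k} {A B : Mat k} → (∀ i j → A i j ≡ B i j) → det A ≡ det B
det-cong {zero}  A≗B = refl
det-cong {suc k} A≗B = sumF-cong λ j →
  cong₂ (λ a d → sign j (a *F d)) (A≗B zero j) (det-cong λ i l → A≗B (suc i) (punchIn j l))

sign-id : ∀ {k} (j : Fin k) x → sign j x ≡ x
sign-id zero    x = refl
sign-id (suc j) x = sign-id j x

-- In characteristic 2 the signs of the cofactor expansion disappear.
det-expand₀ : ∀ {k} (A : Mat (suc k)) → det A ≡ sumF (λ j → A zero j *F det (minor zero j A))
det-expand₀ A = sumF-cong {f = λ j → sign j (A zero j *F det (minor zero j A))} λ j → sign-id j _

punchIn-punchOut-comm : ∀ {m} {a b : Fin (suc (suc m))} (a≢b : a ≢ b) (b≢a : b ≢ a) (c : Fin m) →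
  punchIn a (punchIn (punchOut a≢b) c) ≡ punchIn b (punchIn (punchOut b≢a) c)
punchIn-punchOut-comm {a = zero}  {zero}  a≢b _ c = ⊥-elim (a≢b refl)
punchIn-punchOut-comm {a = zero}  {suc b} _   _ c = refl
punchIn-punchOut-comm {a = suc a} {zero}  _   _ c = refl
punchIn-punchOut-comm {zero}  {suc zero} {suc zero} a≢b _ c = ⊥-elim (a≢b refl)
punchIn-punchOut-comm {suc m} {suc a} {suc b} _ _ zero = refl
punchIn-punchOut-comm {suc m} {suc a} {suc b} a≢b b≢a (suc c) =
  cong suc (punchIn-punchOut-comm (a≢b ∘ cong suc) (b≢a ∘ cong suc) c)

-- The columns other than a and b, in increasing order (junk value when a = b).
otherColumns : ∀ {m} → Fin (suc (suc m)) → Fin (suc (suc m)) → Fin m → Fin (suc (suc m))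
otherColumns a b c with a ≟ b
... | yes _   = a
... | no  a≢b = punchIn a (punchIn (punchOut a≢b) c)

otherColumns-punchInʳ : ∀ {m} (a : Fin (suc (suc m))) l c →
  otherColumns a (punchIn a l) c ≡ punchIn a (punchIn l c)
otherColumns-punchInʳ a l c with a ≟ punchIn a l
... | yes a≡a' = ⊥-elim (punchInᵢ≢i a l (sym a≡a'))
... | no  _    = cong (λ t → punchIn a (punchIn t c)) (trans (punchOut-cong a refl) (punchOut-punchIn a))

otherColumns-punchInˡ : ∀ {m} (b : Fin (suc (suc m))) l c →
  otherColumns (punchIn b l) b c ≡ punchIn b (punchIn l c)
otherColumns-punchInˡ b l c with punchIn b l ≟ b
... | yes b'≡b = ⊥-elim (punchInᵢ≢i b l b'≡b)
... | no  b'≢b = trans (punchIn-punchOut-comm b'≢b (b'≢b ∘ sym) c)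
                       (cong (λ t → punchIn b (punchIn t c)) (trans (punchOut-cong b refl) (punchOut-punchIn b)))

-- Expanding along row 0 and then row p + 1 is a sum over ordered pairs of
-- distinct columns; exchanging the two summations gives the expansion
-- along row p + 1 followed by row 0.
det-expand : ∀ {k} (A : Mat (suc k)) (p : Fin (suc k)) → det A ≡ sumF (λ j → A p j *F det (minor p j A))
det-expand A zero = det-expand₀ A
det-expand {suc m} A (suc p) = begin
  det A
    ≡⟨ det-expand₀ A ⟩
  sumF (λ a → A zero a *F det (minor zero a A))
    ≡⟨ sumF-cong (λ a → cong (A zero a *F_) (det-expand (minor zero a A) p)) ⟩
  sumF (λ a → A zero a *F sumF (λ l → A (suc p) (punchIn a l) *F det (minor p l (minor zero a A))))
    ≡⟨ sumF-cong (λ a → sym (sumF-*ˡ (A zero a) (λ l → A (suc p) (punchIn a l) *F det (minor p l (minor zero a A))))) ⟩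
  sumF (λ a → sumF (λ l → A zero a *F (A (suc p) (punchIn a l) *F det (minor p l (minor zero a A)))))
    ≡⟨ sumF-cong (λ a → sumF-cong (λ l → cong (λ d → A zero a *F (A (suc p) (punchIn a l) *F d))
         (det-cong (λ i c → cong (A (suc (punchIn p i))) (sym (otherColumns-punchInʳ a l c)))))) ⟩
  sumF (λ a → sumF (λ l → G a (punchIn a l)))
    ≡⟨ sumF-offDiagonal-swap G ⟩
  sumF (λ b → sumF (λ l → G (punchIn b l) b))
    ≡⟨ sumF-cong (λ b → sumF-cong (λ l → trans (*-rotate (A zero (punchIn b l)) (A (suc p) b) _)
         (cong (λ d → A (suc p) b *F (A zero (punchIn b l) *F d))
           (det-cong (λ i c → cong (A (suc (punchIn p i))) (otherColumns-punchInˡ b l c)))))) ⟩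
  sumF (λ b → sumF (λ l → A (suc p) b *F (A zero (punchIn b l) *F det (minor zero l (minor (suc p) b A)))))
    ≡⟨ sumF-cong (λ b → sumF-*ˡ (A (suc p) b) (λ l → A zero (punchIn b l) *F det (minor zero l (minor (suc p) b A)))) ⟩
  sumF (λ b → A (suc p) b *F sumF (λ l → A zero (punchIn b l) *F det (minor zero l (minor (suc p) b A))))
    ≡⟨ sumF-cong (λ b → cong (A (suc p) b *F_) (sym (det-expand₀ (minor (suc p) b A)))) ⟩
  sumF (λ j → A (suc p) j *F det (minor (suc p) j A))
    ∎
  where
  open ≡-Reasoning
  G : Fin (suc (suc m)) → Fin (suc (suc m)) → GF4
  G a b = A zero a *F (A (suc p) b *F det (λ i c → A (suc (punchIn p i)) (otherColumns a b c)))

det-zeroRow : ∀ {k} (A : Mat (suc k)) p → (∀ j → A p j ≡ 𝟎) → det A ≡ 𝟎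
det-zeroRow A p row≡0 = trans (det-expand A p) (sumF-zero _ λ j → cong (_*F det (minor p j A)) (row≡0 j))

det-2×2 : (A : Mat 2) →
  det A ≡ (A zero zero *F A (suc zero) (suc zero)) +F (A zero (suc zero) *F A (suc zero) zero)
det-2×2 A = expanded (A zero zero) (A zero (suc zero)) (A (suc zero) zero) (A (suc zero) (suc zero))
  where
  expanded : ∀ a b c d → (a *F ((d *F 𝟏) +F 𝟎)) +F ((b *F ((c *F 𝟏) +F 𝟎)) +F 𝟎) ≡ (a *F d) +F (b *F c)
  expanded = from-yes (every? λ a → every? λ b → every? λ c → every? λ d →
    (a *F ((d *F 𝟏) +F 𝟎)) +F ((b *F ((c *F 𝟏) +F 𝟎)) +F 𝟎) ≟F (a *F d) +F (b *F c))

det-equalRows₂ : (A : Mat 2) → (∀ j → A zero j ≡ A (suc zero) j) → det A ≡ 𝟎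
det-equalRows₂ A rows = begin
  det A                                                  ≡⟨ det-2×2 A ⟩
  (A zero zero *F A (suc zero) (suc zero)) +F (A zero (suc zero) *F A (suc zero) zero)
    ≡⟨ cong₂ (λ x y → (A zero zero *F x) +F (A zero (suc zero) *F y)) (sym (rows (suc zero))) (sym (rows zero)) ⟩
  (A zero zero *F A zero (suc zero)) +F (A zero (suc zero) *F A zero zero)
    ≡⟨ cong ((A zero zero *F A zero (suc zero)) +F_) (*-comm (A zero (suc zero)) _) ⟩
  (A zero zero *F A zero (suc zero)) +F (A zero zero *F A zero (suc zero))
    ≡⟨ x+x≡0 (A zero zero *F A zero (suc zero)) ⟩
  𝟎                                                      ∎
  where open ≡-Reasoning

thirdRow : ∀ {m} (p q : Fin (suc (suc (suc m)))) → ∃ λ r → r ≢ p × r ≢ q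
thirdRow (suc p)        (suc q)        = zero , (λ ()) , (λ ())
thirdRow zero           zero           = suc zero , (λ ()) , (λ ())
thirdRow zero           (suc zero)     = suc (suc zero) , (λ ()) , (λ ())
thirdRow zero           (suc (suc q))  = suc zero , (λ ()) , (λ ())
thirdRow (suc zero)     zero           = suc (suc zero) , (λ ()) , (λ ())
thirdRow (suc (suc p))  zero           = suc zero , (λ ()) , (λ ())

-- For three or more rows, expand along a row r different from both equal
-- rows: every minor still has two equal rows.
det-equalRows : ∀ {k} (A : Mat k) {p q} → p ≢ q → (∀ j → A p j ≡ A q j) → det A ≡ 𝟎
det-equalRows {1} A {zero} {zero} p≢q _ = ⊥-elim (p≢q refl)
det-equalRows {2} A {zero} {zero} p≢q _ = ⊥-elim (p≢q refl)
det-equalRows {2} A {zero} {suc zero} _ rows = det-equalRows₂ A rows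
det-equalRows {2} A {suc zero} {zero} _ rows = det-equalRows₂ A (sym ∘ rows)
det-equalRows {2} A {suc zero} {suc zero} p≢q _ = ⊥-elim (p≢q refl)
det-equalRows {suc (suc (suc m))} A {p} {q} p≢q rows = trans (det-expand A r) (sumF-zero _ λ j →
  trans (cong (A r j *F_) (det-equalRows (minor r j A) p′≢q′ (rows′ j))) (*-zeroʳ (A r j)))
  where
  r = proj₁ (thirdRow p q)
  r≢p = proj₁ (proj₂ (thirdRow p q))
  r≢q = proj₂ (proj₂ (thirdRow p q))
  p′≢q′ : punchOut r≢p ≢ punchOut r≢q
  p′≢q′ eq = p≢q (trans (sym (punchIn-punchOut r≢p)) (trans (cong (punchIn r) eq) (punchIn-punchOut r≢q)))
  rows′ : ∀ j l → minor r j A (punchOut r≢p) l ≡ minor r j A (punchOut r≢q) l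
  rows′ j l = trans (cong (λ t → A t (punchIn j l)) (punchIn-punchOut r≢p))
             (trans (rows (punchIn j l)) (cong (λ t → A t (punchIn j l)) (sym (punchIn-punchOut r≢q))))

setRow : ∀ {k} → Fin k → (Fin k → GF4) → Mat k → Mat k
setRow p r A i j = if does (i ≟ p) then r j else A i j

setRow-updates : ∀ {k} (p : Fin k) r A j → setRow p r A p j ≡ r j
setRow-updates p r A j rewrite dec-true (p ≟ p) refl = refl

setRow-minimal : ∀ {k} {p i : Fin k} r A j → i ≢ p → setRow p r A i j ≡ A i j
setRow-minimal {p = p} {i} r A j i≢p rewrite dec-false (i ≟ p) i≢p = refl

det-setRow : ∀ {k} (A : Mat (suc k)) p r → det (setRow p r A) ≡ sumF (λ j → r j *F det (minor p j A))
det-setRow A p r = trans (det-expand (setRow p r A) p) (sumF-cong λ j →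
  cong₂ _*F_ (setRow-updates p r A j) (det-cong λ i c → setRow-minimal r A (punchIn j c) (punchInᵢ≢i p i)))

otherRow : ∀ {m} (p : Fin (suc (suc m))) → ∃ λ r → r ≢ p
otherRow zero    = suc zero , λ ()
otherRow (suc p) = zero , λ ()

-- Adding multiples of row p to the other rows: expand along a row r ≠ p,
-- whose contribution is det A plus h r times a determinant with two equal rows.
det-addRowMultiples : ∀ {k} (A : Mat (suc k)) (h : Fin (suc k) → GF4) p → h p ≡ 𝟎 →
  det (λ i j → A i j +F (h i *F A p j)) ≡ det A
det-addRowMultiples {zero} A h zero hp≡0 =
  det-cong {A = λ i j → A i j +F (h i *F A zero j)} {B = A}
    λ { zero j → trans (cong (λ t → A zero j +F (t *F A zero j)) hp≡0) (+-identityʳ (A zero j)) }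
det-addRowMultiples {suc m} A h p hp≡0 with otherRow p
... | r , r≢p = begin
  det A′                                                            ≡⟨ det-expand A′ r ⟩
  sumF (λ j → A′ r j *F det (minor r j A′))                         ≡⟨ sumF-cong (λ j → cong (A′ r j *F_) (minors j)) ⟩
  sumF (λ j → (A r j +F (h r *F A p j)) *F d j)                     ≡⟨ sumF-cong (λ j → *-distribʳ-+ (d j) (A r j) (h r *F A p j)) ⟩
  sumF (λ j → (A r j *F d j) +F ((h r *F A p j) *F d j))            ≡⟨ sumF-+ (λ j → A r j *F d j) (λ j → (h r *F A p j) *F d j) ⟩
  sumF (λ j → A r j *F d j) +F sumF (λ j → (h r *F A p j) *F d j)
    ≡⟨ cong₂ _+F_ (sym (det-expand A r))
         (trans (sumF-cong (λ j → *-assoc (h r) (A p j) (d j))) (sumF-*ˡ (h r) (λ j → A p j *F d j))) ⟩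
  det A +F (h r *F sumF (λ j → A p j *F d j))                       ≡⟨ cong (λ t → det A +F (h r *F t)) (sym (det-setRow A r (A p))) ⟩
  det A +F (h r *F det (setRow r (A p) A))                          ≡⟨ cong (λ t → det A +F (h r *F t)) equalRows ⟩
  det A +F (h r *F 𝟎)                                               ≡⟨ trans (cong (det A +F_) (*-zeroʳ (h r))) (+-identityʳ (det A)) ⟩
  det A                                                             ∎
  where
  open ≡-Reasoning
  A′ : Mat (suc (suc m))
  A′ i j = A i j +F (h i *F A p j)
  d : Fin (suc (suc m)) → GF4
  d j = det (minor r j A)
  minors : ∀ j → det (minor r j A′) ≡ d j
  minors j = trans
    (det-cong λ i c → cong (λ t → A (punchIn r i) (punchIn j c) +F (h (punchIn r i) *F A t (punchIn j c)))
                           (sym (punchIn-punchOut r≢p)))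
    (det-addRowMultiples (minor r j A) (h ∘ punchIn r) (punchOut r≢p) (trans (cong h (punchIn-punchOut r≢p)) hp≡0))
  equalRows : det (setRow r (A p) A) ≡ 𝟎
  equalRows = det-equalRows (setRow r (A p) A) r≢p λ j →
    trans (setRow-updates r (A p) A j) (sym (setRow-minimal (A p) A j (r≢p ∘ sym)))

det-zeroCol : ∀ {k} (A : Mat k) q → (∀ i → A i q ≡ 𝟎) → det A ≡ 𝟎
det-zeroCol {suc k} A q col≡0 = begin
  det A                                                     ≡⟨ det-expand₀ A ⟩
  sumF (λ j → A zero j *F det (minor zero j A))             ≡⟨ sumF-punchIn q (λ j → A zero j *F det (minor zero j A)) ⟩
  (A zero q *F det (minor zero q A)) +F sumF (λ l → A zero (punchIn q l) *F det (minor zero (punchIn q l) A))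
    ≡⟨ cong₂ _+F_ (cong (_*F det (minor zero q A)) (col≡0 zero)) (sumF-zero _ λ l →
         trans (cong (A zero (punchIn q l) *F_) (minorsVanish l)) (*-zeroʳ (A zero (punchIn q l)))) ⟩
  𝟎                                                         ∎
  where
  open ≡-Reasoning
  minorsVanish : ∀ l → det (minor zero (punchIn q l) A) ≡ 𝟎
  minorsVanish l = det-zeroCol (minor zero (punchIn q l) A) (punchOut (punchInᵢ≢i q l))
    λ i → trans (cong (A (suc i)) (punchIn-punchOut (punchInᵢ≢i q l))) (col≡0 (suc i))

-- The Schur complement of the diagonal entry A p p (signs vanish in
-- characteristic 2, and the entry is meant to be 1).
schur : ∀ {k} → Fin (suc k) → Mat (suc k) → Mat k
schur p A i j = A (punchIn p i) (punchIn p j) +F (A (punchIn p i) p *F A p (punchIn p j))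

-- Clear column p by adding multiples of row p, then expand along row p.
det-schur : ∀ {k} (A : Mat (suc k)) p → A p p ≡ 𝟏 → det A ≡ det (schur p A)
det-schur {k} A p App≡1 = begin
  det A                                              ≡⟨ sym (det-addRowMultiples A h p hp≡0) ⟩
  det A′                                             ≡⟨ det-expand A′ p ⟩
  sumF (λ j → A′ p j *F det (minor p j A′))          ≡⟨ sumF-punchIn p (λ j → A′ p j *F det (minor p j A′)) ⟩
  (A′ p p *F det (minor p p A′)) +F sumF (λ l → A′ p (punchIn p l) *F det (minor p (punchIn p l) A′))
    ≡⟨ cong₂ _+F_ (cong (_*F det (minor p p A′)) (trans (rowp p) App≡1)) (sumF-zero _ λ l →
         trans (cong (A′ p (punchIn p l) *F_) (minorsVanish l)) (*-zeroʳ (A′ p (punchIn p l)))) ⟩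
  (𝟏 *F det (minor p p A′)) +F 𝟎                     ≡⟨ trans (+-identityʳ _) (*-identityˡ _) ⟩
  det (minor p p A′)                                 ≡⟨ det-cong (λ i j → cong (λ t → A (punchIn p i) (punchIn p j) +F (t *F A p (punchIn p j))) (h-punchIn i)) ⟩
  det (schur p A)                                    ∎
  where
  open ≡-Reasoning
  h : Fin (suc k) → GF4
  h i = if does (i ≟ p) then 𝟎 else A i p
  hp≡0 : h p ≡ 𝟎
  hp≡0 rewrite dec-true (p ≟ p) refl = refl
  h-punchIn : ∀ i → h (punchIn p i) ≡ A (punchIn p i) p
  h-punchIn i rewrite dec-false (punchIn p i ≟ p) (punchInᵢ≢i p i) = refl
  A′ : Mat (suc k)
  A′ i j = A i j +F (h i *F A p j)
  rowp : ∀ j → A′ p j ≡ A p j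
  rowp j = trans (cong (λ t → A p j +F (t *F A p j)) hp≡0) (+-identityʳ _)
  columnp : ∀ i → A′ (punchIn p i) p ≡ 𝟎
  columnp i = begin
    A (punchIn p i) p +F (h (punchIn p i) *F A p p)      ≡⟨ cong₂ (λ x y → A (punchIn p i) p +F (x *F y)) (h-punchIn i) App≡1 ⟩
    A (punchIn p i) p +F (A (punchIn p i) p *F 𝟏)        ≡⟨ x+x*1≡0 (A (punchIn p i) p) ⟩
    𝟎                                                    ∎
    where
    x+x*1≡0 : ∀ x → x +F (x *F 𝟏) ≡ 𝟎
    x+x*1≡0 = from-yes (every? λ x → x +F (x *F 𝟏) ≟F 𝟎)
  minorsVanish : ∀ l → det (minor p (punchIn p l) A′) ≡ 𝟎
  minorsVanish l = det-zeroCol (minor p (punchIn p l) A′) (punchOut (punchInᵢ≢i p l))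
    λ i → trans (cong (A′ (punchIn p i)) (punchIn-punchOut (punchInᵢ≢i p l))) (columnp i)

toggle : ∀ {k} → Fin k → Mat k → Mat k
toggle p A i j = if does (i ≟ p) ∧ does (j ≟ p) then A i j +F 𝟏 else A i j

toggle-diagonal : ∀ {k} (p : Fin k) A → toggle p A p p ≡ A p p +F 𝟏
toggle-diagonal p A rewrite dec-true (p ≟ p) refl = refl

toggle-offRow : ∀ {k} {p i : Fin k} A j → i ≢ p → toggle p A i j ≡ A i j
toggle-offRow {p = p} {i} A j i≢p rewrite dec-false (i ≟ p) i≢p = refl

toggle-offColumn : ∀ {k} {p j : Fin k} A i → j ≢ p → toggle p A i j ≡ A i j
toggle-offColumn {p = p} {j} A i j≢p rewrite dec-false (j ≟ p) j≢p | ∧-zeroʳ (does (i ≟ p)) = refl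

det-toggle : ∀ {k} (A : Mat (suc k)) p → det (toggle p A) ≡ det A +F det (minor p p A)
det-toggle A p = begin
  det T                                                       ≡⟨ det-expand T p ⟩
  sumF (λ j → T p j *F det (minor p j T))                     ≡⟨ sumF-cong (λ j → cong (T p j *F_) (det-cong λ i c →
                                                                   toggle-offRow A (punchIn j c) (punchInᵢ≢i p i))) ⟩
  sumF (λ j → T p j *F d j)                                   ≡⟨ sumF-punchIn p (λ j → T p j *F d j) ⟩
  (T p p *F d p) +F sumF (λ l → T p (punchIn p l) *F d (punchIn p l))
    ≡⟨ cong₂ (λ x y → (x *F d p) +F y) (toggle-diagonal p A)
         (sumF-cong λ l → cong (_*F d (punchIn p l)) (toggle-offColumn A p (punchInᵢ≢i p l))) ⟩
  ((A p p +F 𝟏) *F d p) +F sumF (λ l → A p (punchIn p l) *F d (punchIn p l))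
    ≡⟨ regroup (A p p) (d p) _ ⟩
  ((A p p *F d p) +F sumF (λ l → A p (punchIn p l) *F d (punchIn p l))) +F d p
    ≡⟨ cong (_+F d p) (sym (trans (det-expand A p) (sumF-punchIn p (λ j → A p j *F d j)))) ⟩
  det A +F d p                                                ∎
  where
  open ≡-Reasoning
  T = toggle p A
  d = λ j → det (minor p j A)
  regroup : ∀ a m s → ((a +F 𝟏) *F m) +F s ≡ ((a *F m) +F s) +F m
  regroup = from-yes (every? λ a → every? λ m → every? λ s → ((a +F 𝟏) *F m) +F s ≟F ((a *F m) +F s) +F m)

invSymmetric-minor : ∀ {k} (A : Mat (suc k)) p → InvSymmetric A → InvSymmetric (minor p p A)
invSymmetric-minor A p H i j = H (punchIn p i) (punchIn p j)

invSymmetric-schur : ∀ {k} (A : Mat (suc k)) p → InvSymmetric A → InvSymmetric (schur p A)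
invSymmetric-schur A p H i j = begin
  inv (A j′ i′ +F (A j′ p *F A p i′))             ≡⟨ inv-+-* (A j′ i′) (A j′ p) (A p i′) ⟩
  inv (A j′ i′) +F (inv (A p i′) *F inv (A j′ p))  ≡⟨ cong₂ _+F_ (H i′ j′) (cong₂ _*F_ (H i′ p) (H p j′)) ⟩
  A i′ j′ +F (A i′ p *F A p j′)                    ∎
  where
  open ≡-Reasoning
  i′ = punchIn p i
  j′ = punchIn p j

invSymmetric-toggle : ∀ {k} (A : Mat k) p → InvSymmetric A → InvSymmetric (toggle p A)
invSymmetric-toggle A p H i j with i ≟ p | j ≟ p
... | yes refl | yes refl = trans (inv-+ (A i i) 𝟏) (cong (_+F 𝟏) (H i i))
... | yes _    | no _     = H i j
... | no _     | yes _    = H i j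
... | no _     | no _     = H i j

det-binary : ∀ {k} (A : Mat k) → InvSymmetric A → Binary (det A)
det-binary-unitCorner : ∀ {k} (A : Mat (suc k)) → InvSymmetric A → A zero zero ≡ 𝟏 → Binary (det A)

det-binary {zero}  A H = refl
det-binary {suc k} A H with binary⇒0⊎1 (A zero zero) (H zero zero)
... | inj₂ A₀₀≡1 = det-binary-unitCorner A H A₀₀≡1
... | inj₁ A₀₀≡0 = subst Binary (sym det≡) (binary-+
      (det-binary-unitCorner T (invSymmetric-toggle A zero H) T₀₀≡1)
      (det-binary (minor zero zero A) (invSymmetric-minor A zero H)))
  where
  T = toggle zero A
  T₀₀≡1 : T zero zero ≡ 𝟏
  T₀₀≡1 = trans (toggle-diagonal zero A) (cong (_+F 𝟏) A₀₀≡0)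
  det≡ : det A ≡ det T +F det (minor zero zero A)
  det≡ = sym (trans (cong (_+F det (minor zero zero A)) (det-toggle A zero)) (x+y+y≡x _ _))

det-binary-unitCorner A H A₀₀≡1 =
  subst Binary (sym (det-schur A zero A₀₀≡1)) (det-binary (schur zero A) (invSymmetric-schur A zero H))

-- The principal pivot transform at u of a matrix with C u u = 1: row and
-- column u are unchanged (signs vanish in characteristic 2).
pivot : ∀ {k} → Fin k → Mat k → Mat k
pivot u C i j = if does (i ≟ u) ∨ does (j ≟ u) then C i j else C i j +F (C i u *F C u j)

pivot-row : ∀ {k} (u : Fin k) C j → pivot u C u j ≡ C u j
pivot-row u C j rewrite dec-true (u ≟ u) refl = refl

pivot-column : ∀ {k} (u : Fin k) C i → pivot u C i u ≡ C i u
pivot-column u C i rewrite dec-true (u ≟ u) refl | ∨-zeroʳ (does (i ≟ u)) = refl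

pivot-offRowColumn : ∀ {k} {u i j : Fin k} C → i ≢ u → j ≢ u → pivot u C i j ≡ C i j +F (C i u *F C u j)
pivot-offRowColumn {u = u} {i} {j} C i≢u j≢u rewrite dec-false (i ≟ u) i≢u | dec-false (j ≟ u) j≢u = refl

invSymmetric-pivot : ∀ {k} (C : Mat k) u → InvSymmetric C → InvSymmetric (pivot u C)
invSymmetric-pivot C u H i j with i ≟ u | j ≟ u
... | yes _    | yes _    = H i j
... | yes _    | no _     = H i j
... | no _     | yes _    = H i j
... | no _     | no _     = trans (inv-+-* (C j i) (C j u) (C u i))
                               (cong₂ _+F_ (H i j) (cong₂ _*F_ (H i u) (H u j)))

△-assoc : ∀ {n} (X Y Z : Subset n) → (X △ Y) △ Z ≡ X △ (Y △ Z)
△-assoc = zipWith-assoc Bool.xor-assoc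

△-comm : ∀ {n} (X Y : Subset n) → X △ Y ≡ Y △ X
△-comm = zipWith-comm Bool.xor-comm

△-identityʳ : ∀ {n} (X : Subset n) → X △ ⊥ ≡ X
△-identityʳ = zipWith-identityʳ Bool.xor-identityʳ

△-identityˡ : ∀ {n} (X : Subset n) → ⊥ △ X ≡ X
△-identityˡ = zipWith-identityˡ Bool.xor-identityˡ

△-self : ∀ {n} (X : Subset n) → X △ X ≡ ⊥
△-self []      = refl
△-self (x ∷ X) = cong₂ _∷_ (Bool.xor-same x) (△-self X)

△-cancelʳ : ∀ {n} (X Y : Subset n) → (X △ Y) △ Y ≡ X
△-cancelʳ X Y = trans (△-assoc X Y Y) (trans (cong (X △_) (△-self Y)) (△-identityʳ X))

△-cancelˡ : ∀ {n} (X Y : Subset n) → (X △ Y) △ X ≡ Y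
△-cancelˡ X Y = trans (cong (_△ X) (△-comm X Y)) (△-cancelʳ Y X)

△-cancel-middle : ∀ {n} (X Y Z : Subset n) → (X △ Y) △ (Y △ Z) ≡ X △ Z
△-cancel-middle X Y Z = begin
  (X △ Y) △ (Y △ Z)   ≡⟨ △-assoc X Y (Y △ Z) ⟩
  X △ (Y △ (Y △ Z))   ≡⟨ cong (X △_) (sym (△-assoc Y Y Z)) ⟩
  X △ ((Y △ Y) △ Z)   ≡⟨ cong (λ S → X △ (S △ Z)) (△-self Y) ⟩
  X △ (⊥ △ Z)         ≡⟨ cong (X △_) (△-identityˡ Z) ⟩
  X △ Z               ∎
  where open ≡-Reasoning

△-⁅⁆ : ∀ {n} (Z : Subset n) u → Z △ ⁅ u ⁆ ≡ Z [ u ]≔ not (lookup Z u)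
△-⁅⁆ (z ∷ Z) zero    = cong₂ _∷_ (Bool.xor-comm z true) (△-identityʳ Z)
△-⁅⁆ (z ∷ Z) (suc u) = cong₂ _∷_ (Bool.xor-identityʳ z) (△-⁅⁆ Z u)

△-⁅⁆-update : ∀ {n} (Z : Subset n) u b → (Z [ u ]≔ b) △ ⁅ u ⁆ ≡ Z [ u ]≔ not b
△-⁅⁆-update Z u b = trans (△-⁅⁆ (Z [ u ]≔ b) u)
  (trans (cong (λ t → (Z [ u ]≔ b) [ u ]≔ not t) (lookup∘update u Z b)) ([]≔-idempotent Z u))

[]≔false-△-⁅⁆ : ∀ {n} (X : Subset n) u → lookup X u ≡ true → (X [ u ]≔ false) △ ⁅ u ⁆ ≡ X
[]≔false-△-⁅⁆ X u Xu = trans (△-⁅⁆-update X u false) (trans (cong (X [ u ]≔_) (sym Xu)) ([]≔-lookup X u))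

△-update : ∀ {n} (Z X : Subset n) u b → lookup X u ≡ false → (Z △ X) [ u ]≔ b ≡ (Z [ u ]≔ b) △ X
△-update (z ∷ Z) (x ∷ X) zero    b refl = cong (_∷ (Z △ X)) (sym (Bool.xor-identityʳ b))
△-update (z ∷ Z) (x ∷ X) (suc u) b Xu   = cong ((z xor x) ∷_) (△-update Z X u b Xu)

lookup-⁅⁆-≢ : ∀ {n} {u v : Fin n} → v ≢ u → lookup ⁅ u ⁆ v ≡ false
lookup-⁅⁆-≢ {u = zero}  {zero}  v≢u = ⊥-elim (v≢u refl)
lookup-⁅⁆-≢ {u = zero}  {suc v} _   = lookup-replicate v false
lookup-⁅⁆-≢ {u = suc u} {zero}  _   = refl
lookup-⁅⁆-≢ {u = suc u} {suc v} v≢u = lookup-⁅⁆-≢ (v≢u ∘ cong suc)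

∣[]≔false∣< : ∀ {n} (W : Subset n) u → lookup W u ≡ true → ∣ W [ u ]≔ false ∣ < ∣ W ∣
∣[]≔false∣< (true ∷ W)  zero    _  = ≤-refl
∣[]≔false∣< (true ∷ W)  (suc u) Wu = s≤s (∣[]≔false∣< W u Wu)
∣[]≔false∣< (false ∷ W) (suc u) Wu = ∣[]≔false∣< W u Wu

elems-⊥ : ∀ {n} → elems (⊥ {n}) ≡ []
elems-⊥ {zero}  = refl
elems-⊥ {suc n} = cong (map suc) (elems-⊥ {n})

elems-⁅⁆ : ∀ {n} (u : Fin n) → elems ⁅ u ⁆ ≡ u ∷ []
elems-⁅⁆ {suc n} zero = cong (λ ℓ → zero ∷ map suc ℓ) (elems-⊥ {n})
elems-⁅⁆ (suc u)      = cong (map suc) (elems-⁅⁆ u)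

elems-pair : ∀ {n} {u v : Fin n} → u ≢ v →
  elems (⁅ u ⁆ ∪ ⁅ v ⁆) ≡ u ∷ v ∷ [] ⊎ elems (⁅ u ⁆ ∪ ⁅ v ⁆) ≡ v ∷ u ∷ []
elems-pair {u = zero}  {zero}  u≢v = ⊥-elim (u≢v refl)
elems-pair {u = zero}  {suc v} _   = inj₁ (cong (λ ℓ → zero ∷ map suc ℓ) (trans (cong elems (∪-identityˡ ⁅ v ⁆)) (elems-⁅⁆ v)))
elems-pair {u = suc u} {zero}  _   = inj₂ (cong (λ ℓ → zero ∷ map suc ℓ) (trans (cong elems (∪-identityʳ ⁅ u ⁆)) (elems-⁅⁆ u)))
elems-pair {u = suc u} {suc v} u≢v with elems-pair (u≢v ∘ cong suc)
... | inj₁ eq = inj₁ (cong (map suc) eq)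
... | inj₂ eq = inj₂ (cong (map suc) eq)

elems-⊆ : ∀ {n} (Z : Subset n) → All (λ v → lookup Z v ≡ true) (elems Z)
elems-⊆ []          = []
elems-⊆ (true ∷ Z)  = refl ∷ map⁺ (elems-⊆ Z)
elems-⊆ (false ∷ Z) = map⁺ (elems-⊆ Z)

lookup-elems : ∀ {n} (Z : Subset n) i → lookup Z (L.lookup (elems Z) i) ≡ true
lookup-elems Z i = All.lookup (elems-⊆ Z) (∈-lookup i)

data Insertion {n} (u : Fin n) : List (Fin n) → List (Fin n) → Set where
  here  : ∀ {ℓ} → Insertion u ℓ (u ∷ ℓ)
  there : ∀ {x ℓ ℓ′} → Insertion u ℓ ℓ′ → Insertion u (x ∷ ℓ) (x ∷ ℓ′)

insertion-map-suc : ∀ {n} {u : Fin n} {ℓ ℓ′} → Insertion u ℓ ℓ′ → Insertion (suc u) (map suc ℓ) (map suc ℓ′)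
insertion-map-suc here      = here
insertion-map-suc (there I) = there (insertion-map-suc I)

elems-insertion : ∀ {n} (Z : Subset n) u → Insertion u (elems (Z [ u ]≔ false)) (elems (Z [ u ]≔ true))
elems-insertion (z ∷ Z)     zero    = here
elems-insertion (true ∷ Z)  (suc u) = there (insertion-map-suc (elems-insertion Z u))
elems-insertion (false ∷ Z) (suc u) = insertion-map-suc (elems-insertion Z u)

lookup-insertion : ∀ {n} {u : Fin n} {ℓ ℓ′} → Insertion u ℓ ℓ′ →
  Σ (Fin (suc (length ℓ))) λ p → Σ (length ℓ′ ≡ suc (length ℓ)) λ e →
    ∀ i → L.lookup ℓ′ i ≡ V.insertAt (L.lookup ℓ) p u (cast e i)
lookup-insertion {ℓ = ℓ} here = zero , refl , λ
  { zero    → refl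
  ; (suc i) → cong (L.lookup ℓ) (sym (cast-is-id refl i)) }
lookup-insertion (there I) with lookup-insertion I
... | p , e , ℓ′≗ = suc p , cong suc e , λ { zero → refl ; (suc i) → ℓ′≗ i }

restrict : ∀ {n m} → Mat n → (Fin m → Fin n) → Mat m
restrict A f i j = A (f i) (f j)

det-restrict-cast : ∀ {n m m′} (e : m ≡ m′) (A : Mat n) f g → (∀ i → f i ≡ g (cast e i)) →
  det (restrict A f) ≡ det (restrict A g)
det-restrict-cast refl A f g f≗g = det-cong λ i j →
  cong₂ A (trans (f≗g i) (cong g (cast-is-id refl i))) (trans (f≗g j) (cong g (cast-is-id refl j)))

-- The principal submatrix on Y ∪ {u}, with u at some position of the
-- principal submatrix on Y - {u}.
module Split {n} (Y : Subset n) (u : Fin n) where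

  rest : List (Fin n)
  rest = elems (Y [ u ]≔ false)

  private
    located = lookup-insertion (elems-insertion Y u)

  position : Fin (suc (length rest))
  position = proj₁ located

  index : Fin (suc (length rest)) → Fin n
  index = V.insertAt (L.lookup rest) position u

  det-principal : ∀ A → det (principal A (Y [ u ]≔ true)) ≡ det (restrict A index)
  det-principal A = det-restrict-cast (proj₁ (proj₂ located)) A _ index (proj₂ (proj₂ located))

  index-position : index position ≡ u
  index-position = insertAt-lookup (L.lookup rest) position u

  index-punchIn : ∀ i → index (punchIn position i) ≡ L.lookup rest i
  index-punchIn = insertAt-punchIn (L.lookup rest) position u

  rest-≢ : ∀ i → L.lookup rest i ≢ u
  rest-≢ i eq with trans (sym (lookup∘update u Y false))
                         (subst (λ v → lookup (Y [ u ]≔ false) v ≡ true) eq (lookup-elems (Y [ u ]≔ false) i))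
  ... | ()

  index-punchOut : ∀ {i} (i≢p : i ≢ position) → index i ≡ L.lookup rest (punchOut (i≢p ∘ sym))
  index-punchOut i≢p = trans (cong index (sym (punchIn-punchOut (i≢p ∘ sym)))) (index-punchIn _)

  index-≢ : ∀ {i} → i ≢ position → index i ≢ u
  index-≢ i≢p eq = rest-≢ _ (trans (sym (index-punchOut i≢p)) eq)

  minor-restrict : ∀ A i j → minor position position (restrict A index) i j ≡ principal A (Y [ u ]≔ false) i j
  minor-restrict A i j = cong₂ A (index-punchIn i) (index-punchIn j)

  schur-restrict : ∀ A i j → schur position (restrict A index) i j
    ≡ A (L.lookup rest i) (L.lookup rest j) +F (A (L.lookup rest i) u *F A u (L.lookup rest j))
  schur-restrict A i j rewrite index-punchIn i | index-punchIn j | index-position = refl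

  does-index-≟ : ∀ i → does (index i ≟ u) ≡ does (i ≟ position)
  does-index-≟ i with i ≟ position
  ... | yes refl = dec-true (index i ≟ u) index-position
  ... | no i≢p   = dec-false (index i ≟ u) (index-≢ i≢p)

  lookup-index : lookup Y u ≡ true → ∀ i → lookup Y (index i) ≡ true
  lookup-index Yu i with i ≟ position
  ... | yes refl = subst (λ v → lookup Y v ≡ true) (sym index-position) Yu
  ... | no i≢p   = subst (λ v → lookup Y v ≡ true) (sym (index-punchOut i≢p))
    (trans (sym (lookup∘update′ (rest-≢ _) Y false)) (lookup-elems (Y [ u ]≔ false) _))

⋆-congˡ : ∀ {n} {M N : SetSystem n} X → M ≗ N → M ⋆ X ≗ N ⋆ X
⋆-congˡ X M≗N Z = M≗N (Z △ X)

⋆-congʳ : ∀ {n} (M : SetSystem n) {X Y} → X ≡ Y → M ⋆ X ≗ M ⋆ Y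
⋆-congʳ M X≡Y Z = cong (λ S → M (Z △ S)) X≡Y

⊕-cong : ∀ {n} {M N : SetSystem n} u → M ≗ N → M ⊕ u ≗ N ⊕ u
⊕-cong u M≗N Z = cong₂ (λ a b → a xor (lookup Z u ∧ b)) (M≗N Z) (M≗N (Z [ u ]≔ false))

⋆-⋆ : ∀ {n} (M : SetSystem n) X Y → (M ⋆ X) ⋆ Y ≗ M ⋆ (Y △ X)
⋆-⋆ M X Y Z = cong M (△-assoc Z Y X)

⋆-⊥ : ∀ {n} (M : SetSystem n) → M ⋆ ⊥ ≗ M
⋆-⊥ M Z = cong M (△-identityʳ Z)

⋆-involutive : ∀ {n} (M : SetSystem n) X → (M ⋆ X) ⋆ X ≗ M
⋆-involutive M X Z = cong M (△-cancelʳ Z X)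

⋆-comm : ∀ {n} (M : SetSystem n) X Y → (M ⋆ X) ⋆ Y ≗ (M ⋆ Y) ⋆ X
⋆-comm M X Y Z = cong M (trans (△-assoc Z Y X) (trans (cong (Z △_) (△-comm Y X)) (sym (△-assoc Z X Y))))

⊕-⋆-comm : ∀ {n} (M : SetSystem n) X u → lookup X u ≡ false → (M ⋆ X) ⊕ u ≗ (M ⊕ u) ⋆ X
⊕-⋆-comm M X u Xu Z = cong₂ (λ a b → M (Z △ X) xor (a ∧ M b))
  (trans (sym (Bool.xor-identityʳ (lookup Z u))) (trans (cong (lookup Z u xor_) (sym Xu)) (sym (lookup-zipWith _xor_ u Z X))))
  (sym (△-update Z X u false Xu))

≗-byFibres : ∀ {n} {M N : SetSystem n} u →
  (∀ Y → M (Y [ u ]≔ false) ≡ N (Y [ u ]≔ false)) → (∀ Y → M (Y [ u ]≔ true) ≡ N (Y [ u ]≔ true)) → M ≗ N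
≗-byFibres {M = M} {N} u outside inside Z =
  trans (cong M (sym ([]≔-lookup Z u))) (trans (fibre (lookup Z u)) (cong N ([]≔-lookup Z u)))
  where
  fibre : ∀ b → M (Z [ u ]≔ b) ≡ N (Z [ u ]≔ b)
  fibre false = outside Z
  fibre true  = inside Z

⋆-feasible : ∀ {n} {M N : SetSystem n} {X Y} → M ⋆ X ≗ N ⋆ Y → X ∈ₛ M → Y ∈ₛ N
⋆-feasible {M = M} {N} {X} {Y} M⋆X≗N⋆Y X∈ =
  trans (cong N (sym (△-identityˡ Y))) (trans (sym (M⋆X≗N⋆Y ⊥)) (trans (cong M (△-identityˡ X)) X∈))

⊕-outside : ∀ {n} (N : SetSystem n) Y u → (N ⊕ u) (Y [ u ]≔ false) ≡ N (Y [ u ]≔ false)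
⊕-outside N Y u rewrite lookup∘update u Y false = Bool.xor-identityʳ _

⊕-inside : ∀ {n} (N : SetSystem n) Y u → (N ⊕ u) (Y [ u ]≔ true) ≡ N (Y [ u ]≔ true) xor N (Y [ u ]≔ false)
⊕-inside N Y u rewrite lookup∘update u Y true | []≔-idempotent {x = true} {y = false} Y u = refl

⋆⁅⁆-update : ∀ {n} (N : SetSystem n) Y u b → (N ⋆ ⁅ u ⁆) (Y [ u ]≔ b) ≡ N (Y [ u ]≔ not b)
⋆⁅⁆-update N Y u b = cong N (△-⁅⁆-update Y u b)

⊕-involutive : ∀ {n} (N : SetSystem n) u → (N ⊕ u) ⊕ u ≗ N
⊕-involutive N u = ≗-byFibres u
  (λ Y → trans (⊕-outside (N ⊕ u) Y u) (⊕-outside N Y u))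
  (λ Y → trans (⊕-inside (N ⊕ u) Y u)
    (trans (cong₂ _xor_ (⊕-inside N Y u) (⊕-outside N Y u)) (xor-cancelʳ _ _)))
  where
  xor-cancelʳ : ∀ a b → (a xor b) xor b ≡ a
  xor-cancelʳ a b = trans (Bool.xor-assoc a b b) (trans (cong (a xor_) (Bool.xor-same b)) (Bool.xor-identityʳ a))

⊕-⋆-⊕ : ∀ {n} (N : SetSystem n) u → ((N ⊕ u) ⋆ ⁅ u ⁆) ⊕ u ≗ ((N ⋆ ⁅ u ⁆) ⊕ u) ⋆ ⁅ u ⁆
⊕-⋆-⊕ N u = ≗-byFibres u outside inside
  where
  N⁰ N¹ : Subset _ → Bool
  N⁰ Y = N (Y [ u ]≔ false)
  N¹ Y = N (Y [ u ]≔ true)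
  outside : ∀ Y → (((N ⊕ u) ⋆ ⁅ u ⁆) ⊕ u) (Y [ u ]≔ false) ≡ (((N ⋆ ⁅ u ⁆) ⊕ u) ⋆ ⁅ u ⁆) (Y [ u ]≔ false)
  outside Y = begin
    (((N ⊕ u) ⋆ ⁅ u ⁆) ⊕ u) (Y [ u ]≔ false)      ≡⟨ ⊕-outside ((N ⊕ u) ⋆ ⁅ u ⁆) Y u ⟩
    ((N ⊕ u) ⋆ ⁅ u ⁆) (Y [ u ]≔ false)            ≡⟨ ⋆⁅⁆-update (N ⊕ u) Y u false ⟩
    (N ⊕ u) (Y [ u ]≔ true)                       ≡⟨ ⊕-inside N Y u ⟩
    N¹ Y xor N⁰ Y                                 ≡⟨ Bool.xor-comm (N¹ Y) (N⁰ Y) ⟩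
    N⁰ Y xor N¹ Y                                 ≡⟨ sym (cong₂ _xor_ (⋆⁅⁆-update N Y u true) (⋆⁅⁆-update N Y u false)) ⟩
    (N ⋆ ⁅ u ⁆) (Y [ u ]≔ true) xor (N ⋆ ⁅ u ⁆) (Y [ u ]≔ false) ≡⟨ sym (⊕-inside (N ⋆ ⁅ u ⁆) Y u) ⟩
    ((N ⋆ ⁅ u ⁆) ⊕ u) (Y [ u ]≔ true)             ≡⟨ sym (⋆⁅⁆-update ((N ⋆ ⁅ u ⁆) ⊕ u) Y u false) ⟩
    (((N ⋆ ⁅ u ⁆) ⊕ u) ⋆ ⁅ u ⁆) (Y [ u ]≔ false)  ∎
    where open ≡-Reasoning
  inside : ∀ Y → (((N ⊕ u) ⋆ ⁅ u ⁆) ⊕ u) (Y [ u ]≔ true) ≡ (((N ⋆ ⁅ u ⁆) ⊕ u) ⋆ ⁅ u ⁆) (Y [ u ]≔ true)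
  inside Y = begin
    (((N ⊕ u) ⋆ ⁅ u ⁆) ⊕ u) (Y [ u ]≔ true)       ≡⟨ ⊕-inside ((N ⊕ u) ⋆ ⁅ u ⁆) Y u ⟩
    ((N ⊕ u) ⋆ ⁅ u ⁆) (Y [ u ]≔ true) xor ((N ⊕ u) ⋆ ⁅ u ⁆) (Y [ u ]≔ false)
                                                  ≡⟨ cong₂ _xor_ (⋆⁅⁆-update (N ⊕ u) Y u true) (⋆⁅⁆-update (N ⊕ u) Y u false) ⟩
    (N ⊕ u) (Y [ u ]≔ false) xor (N ⊕ u) (Y [ u ]≔ true) ≡⟨ cong₂ _xor_ (⊕-outside N Y u) (⊕-inside N Y u) ⟩
    N⁰ Y xor (N¹ Y xor N⁰ Y)                      ≡⟨ xor-cancel (N⁰ Y) (N¹ Y) ⟩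
    N¹ Y                                          ≡⟨ sym (⋆⁅⁆-update N Y u false) ⟩
    (N ⋆ ⁅ u ⁆) (Y [ u ]≔ false)                  ≡⟨ sym (⊕-outside (N ⋆ ⁅ u ⁆) Y u) ⟩
    ((N ⋆ ⁅ u ⁆) ⊕ u) (Y [ u ]≔ false)            ≡⟨ sym (⋆⁅⁆-update ((N ⋆ ⁅ u ⁆) ⊕ u) Y u true) ⟩
    (((N ⋆ ⁅ u ⁆) ⊕ u) ⋆ ⁅ u ⁆) (Y [ u ]≔ true)   ∎
    where
    open ≡-Reasoning
    xor-cancel : ∀ a b → a xor (b xor a) ≡ b
    xor-cancel true  b = trans (cong not (Bool.xor-comm b true)) (Bool.not-involutive b)
    xor-cancel false b = Bool.xor-identityʳ b

matrixSystem-toggle : ∀ {n} (C : Mat n) u → InvSymmetric C → matrixSystem (toggle u C) ≗ matrixSystem C ⊕ u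
matrixSystem-toggle C u H = ≗-byFibres u outside inside
  where
  outside : ∀ Y → matrixSystem (toggle u C) (Y [ u ]≔ false) ≡ (matrixSystem C ⊕ u) (Y [ u ]≔ false)
  outside Y = trans (cong nonzero (det-cong λ i j → toggle-offRow C _ (rest-≢ i)))
                    (sym (⊕-outside (matrixSystem C) Y u))
    where open Split Y u
  inside : ∀ Y → matrixSystem (toggle u C) (Y [ u ]≔ true) ≡ (matrixSystem C ⊕ u) (Y [ u ]≔ true)
  inside Y = begin
    nonzero (det (principal (toggle u C) (Y [ u ]≔ true)))     ≡⟨ cong nonzero (det-principal (toggle u C)) ⟩
    nonzero (det (restrict (toggle u C) index))                ≡⟨ cong nonzero (det-cong restrict-toggle) ⟩
    nonzero (det (toggle position Cᵢ))                         ≡⟨ cong nonzero (det-toggle Cᵢ position) ⟩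
    nonzero (det Cᵢ +F det (minor position position Cᵢ))
      ≡⟨ nonzero-+ _ _ (det-binary Cᵢ (λ i j → H (index i) (index j)))
                       (det-binary (minor position position Cᵢ) (λ i j → H (index (punchIn position i)) (index (punchIn position j)))) ⟩
    nonzero (det Cᵢ) xor nonzero (det (minor position position Cᵢ))
      ≡⟨ cong₂ _xor_ (cong nonzero (sym (det-principal C))) (cong nonzero (det-cong (minor-restrict C))) ⟩
    matrixSystem C (Y [ u ]≔ true) xor matrixSystem C (Y [ u ]≔ false) ≡⟨ sym (⊕-inside (matrixSystem C) Y u) ⟩
    (matrixSystem C ⊕ u) (Y [ u ]≔ true)                       ∎
    where
    open ≡-Reasoning
    open Split Y u
    Cᵢ = restrict C index
    restrict-toggle : ∀ i j → restrict (toggle u C) index i j ≡ toggle position Cᵢ i j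
    restrict-toggle i j rewrite does-index-≟ i | does-index-≟ j = refl

matrixSystem-pivot : ∀ {n} (C : Mat n) u → C u u ≡ 𝟏 → matrixSystem (pivot u C) ≗ matrixSystem C ⋆ ⁅ u ⁆
matrixSystem-pivot C u Cuu≡1 = ≗-byFibres u outside inside
  where
  outside : ∀ Y → matrixSystem (pivot u C) (Y [ u ]≔ false) ≡ (matrixSystem C ⋆ ⁅ u ⁆) (Y [ u ]≔ false)
  outside Y = sym (begin
    (matrixSystem C ⋆ ⁅ u ⁆) (Y [ u ]≔ false)               ≡⟨ ⋆⁅⁆-update (matrixSystem C) Y u false ⟩
    nonzero (det (principal C (Y [ u ]≔ true)))             ≡⟨ cong nonzero (det-principal C) ⟩
    nonzero (det (restrict C index))                        ≡⟨ cong nonzero (det-schur (restrict C index) position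
                                                                 (trans (cong₂ C index-position index-position) Cuu≡1)) ⟩
    nonzero (det (schur position (restrict C index)))       ≡⟨ cong nonzero (det-cong λ i j →
                                                                 trans (schur-restrict C i j) (sym (pivot-offRowColumn C (rest-≢ i) (rest-≢ j)))) ⟩
    matrixSystem (pivot u C) (Y [ u ]≔ false)               ∎)
    where
    open ≡-Reasoning
    open Split Y u
  inside : ∀ Y → matrixSystem (pivot u C) (Y [ u ]≔ true) ≡ (matrixSystem C ⋆ ⁅ u ⁆) (Y [ u ]≔ true)
  inside Y = begin
    nonzero (det (principal (pivot u C) (Y [ u ]≔ true)))   ≡⟨ cong nonzero (det-principal (pivot u C)) ⟩
    nonzero (det (restrict (pivot u C) index))              ≡⟨ cong nonzero (det-schur (restrict (pivot u C) index) position
                                                                 (trans (cong₂ (pivot u C) index-position index-position)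
                                                                        (trans (pivot-row u C u) Cuu≡1))) ⟩
    nonzero (det (schur position (restrict (pivot u C) index))) ≡⟨ cong nonzero (det-cong unpivot) ⟩
    nonzero (det (principal C (Y [ u ]≔ false)))            ≡⟨ sym (⋆⁅⁆-update (matrixSystem C) Y u true) ⟩
    (matrixSystem C ⋆ ⁅ u ⁆) (Y [ u ]≔ true)                ∎
    where
    open ≡-Reasoning
    open Split Y u
    unpivot : ∀ i j → schur position (restrict (pivot u C) index) i j ≡ principal C (Y [ u ]≔ false) i j
    unpivot i j = begin
      schur position (restrict (pivot u C) index) i j
        ≡⟨ schur-restrict (pivot u C) i j ⟩
      pivot u C (rᵢ) (rⱼ) +F (pivot u C rᵢ u *F pivot u C u rⱼ)
        ≡⟨ cong₂ _+F_ (pivot-offRowColumn C (rest-≢ i) (rest-≢ j))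
                                  (cong₂ _*F_ (pivot-column u C rᵢ) (pivot-row u C rⱼ)) ⟩
      (C rᵢ rⱼ +F (C rᵢ u *F C u rⱼ)) +F (C rᵢ u *F C u rⱼ)
        ≡⟨ x+y+y≡x (C rᵢ rⱼ) _ ⟩
      C rᵢ rⱼ ∎
      where
      rᵢ = L.lookup rest i
      rⱼ = L.lookup rest j

matrixSystem-zeroRow : ∀ {n} (D : Mat n) Z u → lookup Z u ≡ true →
  (∀ v → lookup Z v ≡ true → D u v ≡ 𝟎) → matrixSystem D Z ≡ false
matrixSystem-zeroRow D Z u Zu row≡0 = begin
  matrixSystem D Z                                   ≡⟨ cong (matrixSystem D) (sym Z≡) ⟩
  nonzero (det (principal D (Z [ u ]≔ true)))        ≡⟨ cong nonzero (det-principal D) ⟩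
  nonzero (det (restrict D index))                   ≡⟨ cong nonzero (det-zeroRow (restrict D index) position λ j →
                                                          trans (cong (λ t → D t (index j)) index-position) (row≡0 _ (lookup-index Zu j))) ⟩
  false                                              ∎
  where
  open ≡-Reasoning
  open Split Z u
  Z≡ : Z [ u ]≔ true ≡ Z
  Z≡ = trans (cong (Z [ u ]≔_) (sym Zu)) ([]≔-lookup Z u)

offDiagonal-nonzero : ∀ {n} (D : Mat n) Y u → D u u ≡ 𝟎 → lookup Y u ≡ true → Y ∈ₛ matrixSystem D →
  ∃ λ v → (lookup Y v ≡ true × v ≢ u) × D u v ≢ 𝟎
offDiagonal-nonzero D Y u Duu≡0 Yu Y∈ with any? (λ v → ((lookup Y v Bool.≟ true) ×-dec ¬? (v ≟ u)) ×-dec ¬? (D u v ≟F 𝟎))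
... | yes found = found
... | no ∄v = contradiction (trans (sym Y∈) (matrixSystem-zeroRow D Y u Yu rowZero)) λ ()
  where
  rowZero : ∀ v → lookup Y v ≡ true → D u v ≡ 𝟎
  rowZero v Yv with v ≟ u | D u v ≟F 𝟎
  ... | yes refl | _        = Duu≡0
  ... | no _     | yes Duv≡0 = Duv≡0
  ... | no v≢u   | no Duv≢0  = ⊥-elim (∄v (v , (Yv , v≢u) , Duv≢0))

matrixSystem-∅ : ∀ {n} (C : Mat n) → ⊥ ∈ₛ matrixSystem C
matrixSystem-∅ C = cong (λ ℓ → nonzero (det (restrict C (L.lookup ℓ)))) elems-⊥

matrixSystem-⁅⁆ : ∀ {n} (C : Mat n) u → C u u ≡ 𝟏 → ⁅ u ⁆ ∈ₛ matrixSystem C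
matrixSystem-⁅⁆ C u Cuu≡1 = trans (cong (λ ℓ → nonzero (det (restrict C (L.lookup ℓ)))) (elems-⁅⁆ u))
                                  (cong (λ x → nonzero ((x *F 𝟏) +F 𝟎)) Cuu≡1)

matrixSystem-pair : ∀ {n} (C : Mat n) {u v} → InvSymmetric C → u ≢ v → C u u ≡ 𝟎 → C u v ≢ 𝟎 →
  (⁅ u ⁆ ∪ ⁅ v ⁆) ∈ₛ matrixSystem C
matrixSystem-pair C {u} {v} H u≢v Cuu≡0 Cuv≢0 with elems-pair u≢v
... | inj₁ uv = trans (cong (λ ℓ → nonzero (det (restrict C (L.lookup ℓ)))) uv) (cong nonzero (begin
  det (restrict C (L.lookup (u ∷ v ∷ [])))       ≡⟨ det-2×2 (restrict C (L.lookup (u ∷ v ∷ []))) ⟩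
  (C u u *F C v v) +F (C u v *F C v u)           ≡⟨ cong₂ (λ x y → (x *F C v v) +F (C u v *F y)) Cuu≡0 (sym (H v u)) ⟩
  𝟎 +F (C u v *F inv (C u v))                    ≡⟨ x*invx≡1 (C u v) Cuv≢0 ⟩
  𝟏                                              ∎))
  where open ≡-Reasoning
... | inj₂ vu = trans (cong (λ ℓ → nonzero (det (restrict C (L.lookup ℓ)))) vu) (cong nonzero (begin
  det (restrict C (L.lookup (v ∷ u ∷ [])))       ≡⟨ det-2×2 (restrict C (L.lookup (v ∷ u ∷ []))) ⟩
  (C v v *F C u u) +F (C v u *F C u v)           ≡⟨ cong₂ (λ x y → (C v v *F x) +F (y *F C u v)) Cuu≡0 (sym (H v u)) ⟩
  (C v v *F 𝟎) +F (inv (C u v) *F C u v)         ≡⟨ cong₂ _+F_ (*-zeroʳ (C v v)) (*-comm (inv (C u v)) (C u v)) ⟩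
  𝟎 +F (C u v *F inv (C u v))                    ≡⟨ x*invx≡1 (C u v) Cuv≢0 ⟩
  𝟏                                              ∎))
  where open ≡-Reasoning

module ≗-Reasoning {n} = SetoidReasoning (Subset n →-setoid Bool)

-- For C u u = 0 the set ∅ is infeasible in M_C * u, so no pivot applies;
-- setting C u u to 1 first (a loop complementation) makes u pivotable.
matrixSystem-⋆-zeroDiagonal : ∀ {n} (C : Mat n) u → InvSymmetric C → C u u ≡ 𝟎 →
  matrixSystem C ⋆ ⁅ u ⁆ ≗ ((matrixSystem (pivot u (toggle u C)) ⊕ u) ⋆ ⁅ u ⁆) ⊕ u
matrixSystem-⋆-zeroDiagonal C u H Cuu≡0 = begin
  matrixSystem C ⋆ ⁅ u ⁆                               ≈⟨ ⋆-congˡ ⁅ u ⁆ retoggle ⟩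
  (matrixSystem T ⊕ u) ⋆ ⁅ u ⁆                         ≈⟨ ⊕-involutive ((matrixSystem T ⊕ u) ⋆ ⁅ u ⁆) u ⟨
  (((matrixSystem T ⊕ u) ⋆ ⁅ u ⁆) ⊕ u) ⊕ u             ≈⟨ ⊕-cong u (⊕-⋆-⊕ (matrixSystem T) u) ⟩
  (((matrixSystem T ⋆ ⁅ u ⁆) ⊕ u) ⋆ ⁅ u ⁆) ⊕ u         ≈⟨ ⊕-cong u (⋆-congˡ ⁅ u ⁆ (⊕-cong u (matrixSystem-pivot T u Tuu≡1))) ⟨
  ((matrixSystem (pivot u T) ⊕ u) ⋆ ⁅ u ⁆) ⊕ u         ∎
  where
  open ≗-Reasoning
  T = toggle u C
  Tuu≡1 : T u u ≡ 𝟏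
  Tuu≡1 = trans (toggle-diagonal u C) (cong (_+F 𝟏) Cuu≡0)
  retoggle : matrixSystem C ≗ matrixSystem T ⊕ u
  retoggle Y = sym (trans (⊕-cong u (matrixSystem-toggle C u H) Y) (⊕-involutive (matrixSystem C) u Y))

⊕-⋆-⊕-zeroDiagonal : ∀ {n} (F : Mat n) u → InvSymmetric F → F u u ≡ 𝟎 →
  ((matrixSystem F ⊕ u) ⋆ ⁅ u ⁆) ⊕ u ≗ matrixSystem (toggle u (pivot u (toggle u F)))
⊕-⋆-⊕-zeroDiagonal F u H Fuu≡0 = begin
  ((matrixSystem F ⊕ u) ⋆ ⁅ u ⁆) ⊕ u                    ≈⟨ ⊕-⋆-⊕ (matrixSystem F) u ⟩
  ((matrixSystem F ⋆ ⁅ u ⁆) ⊕ u) ⋆ ⁅ u ⁆                ≈⟨ ⋆-congˡ ⁅ u ⁆ (⊕-cong u (matrixSystem-⋆-zeroDiagonal F u H Fuu≡0)) ⟩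
  ((((matrixSystem D ⊕ u) ⋆ ⁅ u ⁆) ⊕ u) ⊕ u) ⋆ ⁅ u ⁆    ≈⟨ ⋆-congˡ ⁅ u ⁆ (⊕-involutive ((matrixSystem D ⊕ u) ⋆ ⁅ u ⁆) u) ⟩
  ((matrixSystem D ⊕ u) ⋆ ⁅ u ⁆) ⋆ ⁅ u ⁆                ≈⟨ ⋆-involutive (matrixSystem D ⊕ u) ⁅ u ⁆ ⟩
  matrixSystem D ⊕ u                                    ≈⟨ matrixSystem-toggle D u HD ⟨
  matrixSystem (toggle u D)                             ∎
  where
  open ≗-Reasoning
  D = pivot u (toggle u F)
  HD = invSymmetric-pivot (toggle u F) u (invSymmetric-toggle F u H)

invRepresentable-≗ : ∀ {n} {M N : SetSystem n} → M ≗ N → InvRepresentable N → InvRepresentable M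
invRepresentable-≗ M≗N (C , H , X , N≗) = C , H , X , λ Y → trans (M≗N Y) (N≗ Y)

matrixSystem-invRepresentable : ∀ {n} (C : Mat n) → InvSymmetric C → InvRepresentable (matrixSystem C)
matrixSystem-invRepresentable C H = C , H , ⊥ , λ Y → sym (⋆-⊥ (matrixSystem C) Y)

invRepresentable-⋆ : ∀ {n} {M : SetSystem n} → InvRepresentable M → ∀ X → InvRepresentable (M ⋆ X)
invRepresentable-⋆ (C , H , W , M≗) X =
  C , H , X △ W , λ Y → trans (M≗ (Y △ X)) (⋆-⋆ (matrixSystem C) W X Y)

invRepresentable-⊕-matrixSystem : ∀ {n} (C : Mat n) u → InvSymmetric C → InvRepresentable (matrixSystem C ⊕ u)
invRepresentable-⊕-matrixSystem C u H = invRepresentable-≗ (λ Y → sym (matrixSystem-toggle C u H Y))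
  (matrixSystem-invRepresentable (toggle u C) (invSymmetric-toggle C u H))

invRepresentable-⋆⁅⁆-⊕ : ∀ {n} (C : Mat n) u → InvSymmetric C → InvRepresentable ((matrixSystem C ⋆ ⁅ u ⁆) ⊕ u)
invRepresentable-⋆⁅⁆-⊕ C u H with binary⇒0⊎1 (C u u) (H u u)
... | inj₂ Cuu≡1 = invRepresentable-≗ (⊕-cong u (λ Y → sym (matrixSystem-pivot C u Cuu≡1 Y)))
                     (invRepresentable-⊕-matrixSystem (pivot u C) u (invSymmetric-pivot C u H))
... | inj₁ Cuu≡0 = invRepresentable-≗ twisted
                     (invRepresentable-⋆ (matrixSystem-invRepresentable (toggle u D) (invSymmetric-toggle D u HD)) ⁅ u ⁆)
  where
  D = pivot u (toggle u C)
  HD = invSymmetric-pivot (toggle u C) u (invSymmetric-toggle C u H)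
  twisted : (matrixSystem C ⋆ ⁅ u ⁆) ⊕ u ≗ matrixSystem (toggle u D) ⋆ ⁅ u ⁆
  twisted = begin
    (matrixSystem C ⋆ ⁅ u ⁆) ⊕ u                     ≈⟨ ⊕-cong u (matrixSystem-⋆-zeroDiagonal C u H Cuu≡0) ⟩
    (((matrixSystem D ⊕ u) ⋆ ⁅ u ⁆) ⊕ u) ⊕ u         ≈⟨ ⊕-involutive ((matrixSystem D ⊕ u) ⋆ ⁅ u ⁆) u ⟩
    (matrixSystem D ⊕ u) ⋆ ⁅ u ⁆                     ≈⟨ ⋆-congˡ ⁅ u ⁆ (matrixSystem-toggle D u HD) ⟨
    matrixSystem (toggle u D) ⋆ ⁅ u ⁆                ∎
    where open ≗-Reasoning

-- If u ∈ X, write X = (X - {u}) △ {u} and let the twist by X - {u} commute with +u.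
invRepresentable-⊕ : ∀ {n} {M : SetSystem n} → InvRepresentable M → ∀ u → InvRepresentable (M ⊕ u)
invRepresentable-⊕ {M = M} (C , H , X , M≗) u with lookup X u in Xu
... | false = invRepresentable-≗ (λ Y → trans (⊕-cong u M≗ Y) (⊕-⋆-comm (matrixSystem C) X u Xu Y))
                (invRepresentable-⋆ (invRepresentable-⊕-matrixSystem C u H) X)
... | true = invRepresentable-≗ split (invRepresentable-⋆ (invRepresentable-⋆⁅⁆-⊕ C u H) X⁻)
  where
  X⁻ = X [ u ]≔ false
  split : M ⊕ u ≗ ((matrixSystem C ⋆ ⁅ u ⁆) ⊕ u) ⋆ X⁻
  split = begin
    M ⊕ u                                         ≈⟨ ⊕-cong u M≗ ⟩
    (matrixSystem C ⋆ X) ⊕ u                      ≈⟨ ⊕-cong u (⋆-congʳ (matrixSystem C) ([]≔false-△-⁅⁆ X u Xu)) ⟨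
    (matrixSystem C ⋆ (X⁻ △ ⁅ u ⁆)) ⊕ u           ≈⟨ ⊕-cong u (⋆-⋆ (matrixSystem C) ⁅ u ⁆ X⁻) ⟨
    ((matrixSystem C ⋆ ⁅ u ⁆) ⋆ X⁻) ⊕ u           ≈⟨ ⊕-⋆-comm (matrixSystem C ⋆ ⁅ u ⁆) X⁻ u (lookup∘update u X false) ⟩
    ((matrixSystem C ⋆ ⁅ u ⁆) ⊕ u) ⋆ X⁻           ∎
    where open ≗-Reasoning

invRepresentable-applySeq : ∀ {n} {M : SetSystem n} → InvRepresentable M → ∀ φ → InvRepresentable (applySeq M φ)
invRepresentable-applySeq rep []             = rep
invRepresentable-applySeq rep (piv u  ∷ φ)   = invRepresentable-applySeq (invRepresentable-⋆ rep ⁅ u ⁆) φ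
invRepresentable-applySeq rep (loop u ∷ φ)   = invRepresentable-applySeq (invRepresentable-⊕ rep u) φ

-- Twisting by a pair {u, v} with C[{u, v}] nonsingular but C u u = C v v = 0:
-- replace C u u by 1, pivot at u, then at v (where the entry has become 1).
matrixSystem-⋆-pair : ∀ {n} (C : Mat n) {u v} → InvSymmetric C → v ≢ u → C u u ≡ 𝟎 → C v v ≡ 𝟎 → C u v ≢ 𝟎 →
  Σ (Mat n) λ G → InvSymmetric G × (matrixSystem C ⋆ ⁅ u ⁆) ⋆ ⁅ v ⁆ ≗ matrixSystem G
matrixSystem-⋆-pair C {u} {v} H v≢u Cuu≡0 Cvv≡0 Cuv≢0 =
  toggle u (pivot u (toggle u F)) ,
  invSymmetric-toggle _ u (invSymmetric-pivot _ u (invSymmetric-toggle F u HF)) ,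
  twisted
  where
  a = C u v
  T = toggle u C
  D = pivot u T
  HD = invSymmetric-pivot T u (invSymmetric-toggle C u H)
  F = pivot v D
  HF = invSymmetric-pivot D v HD
  Tvu : T v u ≡ inv a
  Tvu = trans (toggle-offRow C u v≢u) (sym (H v u))
  Tuv : T u v ≡ a
  Tuv = toggle-offColumn C u v≢u
  Dvv≡1 : D v v ≡ 𝟏
  Dvv≡1 = begin
    D v v                       ≡⟨ pivot-offRowColumn T v≢u v≢u ⟩
    T v v +F (T v u *F T u v)   ≡⟨ cong₂ _+F_ (trans (toggle-offRow C v v≢u) Cvv≡0) (cong₂ _*F_ Tvu Tuv) ⟩
    𝟎 +F (inv a *F a)           ≡⟨ trans (*-comm (inv a) a) (x*invx≡1 a Cuv≢0) ⟩
    𝟏                           ∎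
    where open ≡-Reasoning
  Fuu≡0 : F u u ≡ 𝟎
  Fuu≡0 = begin
    F u u                       ≡⟨ pivot-offRowColumn D (v≢u ∘ sym) (v≢u ∘ sym) ⟩
    D u u +F (D u v *F D v u)   ≡⟨ cong₂ _+F_ (pivot-row u T u) (cong₂ _*F_ (pivot-row u T v) (pivot-column u T v)) ⟩
    T u u +F (T u v *F T v u)   ≡⟨ cong₂ _+F_ (trans (toggle-diagonal u C) (cong (_+F 𝟏) Cuu≡0)) (cong₂ _*F_ Tuv Tvu) ⟩
    𝟏 +F (a *F inv a)           ≡⟨ cong (𝟏 +F_) (x*invx≡1 a Cuv≢0) ⟩
    𝟎                           ∎
    where open ≡-Reasoning
  u∉⁅v⁆ = lookup-⁅⁆-≢ (v≢u ∘ sym)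
  twisted : (matrixSystem C ⋆ ⁅ u ⁆) ⋆ ⁅ v ⁆ ≗ matrixSystem (toggle u (pivot u (toggle u F)))
  twisted = begin
    (matrixSystem C ⋆ ⁅ u ⁆) ⋆ ⁅ v ⁆                        ≈⟨ ⋆-congˡ ⁅ v ⁆ (matrixSystem-⋆-zeroDiagonal C u H Cuu≡0) ⟩
    (((matrixSystem D ⊕ u) ⋆ ⁅ u ⁆) ⊕ u) ⋆ ⁅ v ⁆            ≈⟨ ⊕-⋆-comm ((matrixSystem D ⊕ u) ⋆ ⁅ u ⁆) ⁅ v ⁆ u u∉⁅v⁆ ⟨
    (((matrixSystem D ⊕ u) ⋆ ⁅ u ⁆) ⋆ ⁅ v ⁆) ⊕ u            ≈⟨ ⊕-cong u (⋆-comm (matrixSystem D ⊕ u) ⁅ u ⁆ ⁅ v ⁆) ⟩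
    (((matrixSystem D ⊕ u) ⋆ ⁅ v ⁆) ⋆ ⁅ u ⁆) ⊕ u            ≈⟨ ⊕-cong u (⋆-congˡ ⁅ u ⁆ (⊕-⋆-comm (matrixSystem D) ⁅ v ⁆ u u∉⁅v⁆)) ⟨
    (((matrixSystem D ⋆ ⁅ v ⁆) ⊕ u) ⋆ ⁅ u ⁆) ⊕ u            ≈⟨ ⊕-cong u (⋆-congˡ ⁅ u ⁆ (⊕-cong u (matrixSystem-pivot D v Dvv≡1))) ⟨
    ((matrixSystem F ⊕ u) ⋆ ⁅ u ⁆) ⊕ u                      ≈⟨ ⊕-⋆-⊕-zeroDiagonal F u HF Fuu≡0 ⟩
    matrixSystem (toggle u (pivot u (toggle u F)))          ∎
    where open ≗-Reasoning

NormalForm : ∀ {n} → Mat n → Subset n → Set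
NormalForm {n} C W = Σ (Mat n) λ D → InvSymmetric D × matrixSystem C ⋆ W ≗ matrixSystem D

NormalFormsUpTo : ℕ → ℕ → Set
NormalFormsUpTo n k = ∀ {W} (C : Mat n) → InvSymmetric C → ∣ W ∣ ≤ k → W ∈ₛ matrixSystem C → NormalForm C W

normalForm-≗ : ∀ {n k} → NormalFormsUpTo n k → ∀ (C G : Mat n) {W W′} → InvSymmetric G → ∣ W′ ∣ ≤ k →
  matrixSystem C ⋆ W ≗ matrixSystem G ⋆ W′ → W ∈ₛ matrixSystem C → NormalForm C W
normalForm-≗ normalForm C G {W} {W′} HG ∣W′∣≤k C⋆W≗G⋆W′ W∈ with normalForm G HG ∣W′∣≤k (⋆-feasible {M = matrixSystem C} {matrixSystem G} {W} {W′} C⋆W≗G⋆W′ W∈)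
... | D , HD , G⋆W′≗D = D , HD , λ Y → trans (C⋆W≗G⋆W′ Y) (G⋆W′≗D Y)

normalForm-pivot : ∀ {n k} → NormalFormsUpTo n k → ∀ (C : Mat n) {W} → InvSymmetric C → ∣ W ∣ ≤ suc k →
  W ∈ₛ matrixSystem C → ∀ w → lookup W w ≡ true → C w w ≡ 𝟏 → NormalForm C W
normalForm-pivot normalForm C {W} H ∣W∣≤1+k W∈ w Ww Cww≡1 =
  normalForm-≗ normalForm C (pivot w C) (invSymmetric-pivot C w H)
    (s≤s⁻¹ (<-≤-trans (∣[]≔false∣< W w Ww) ∣W∣≤1+k)) C⋆W≗P⋆W⁻ W∈
  where
  W⁻ = W [ w ]≔ false
  C⋆W≗P⋆W⁻ : matrixSystem C ⋆ W ≗ matrixSystem (pivot w C) ⋆ W⁻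
  C⋆W≗P⋆W⁻ = begin
    matrixSystem C ⋆ W                     ≈⟨ ⋆-congʳ (matrixSystem C) ([]≔false-△-⁅⁆ W w Ww) ⟨
    matrixSystem C ⋆ (W⁻ △ ⁅ w ⁆)          ≈⟨ ⋆-⋆ (matrixSystem C) ⁅ w ⁆ W⁻ ⟨
    (matrixSystem C ⋆ ⁅ w ⁆) ⋆ W⁻          ≈⟨ ⋆-congˡ W⁻ (matrixSystem-pivot C w Cww≡1) ⟨
    matrixSystem (pivot w C) ⋆ W⁻          ∎
    where open ≗-Reasoning

normalForm-pair : ∀ {n k} → NormalFormsUpTo n k → ∀ (C : Mat n) {W} → InvSymmetric C → ∣ W ∣ ≤ suc k →
  W ∈ₛ matrixSystem C → ∀ u → lookup W u ≡ true → (∀ w → lookup W w ≡ true → C w w ≡ 𝟎) → NormalForm C W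
normalForm-pair {k = k} normalForm C {W} H ∣W∣≤1+k W∈ u Wu diagonal≡0 =
  viaPair (offDiagonal-nonzero C W u (diagonal≡0 u Wu) Wu W∈)
  where
  W⁻ = W [ u ]≔ false
  viaPair : (∃ λ v → (lookup W v ≡ true × v ≢ u) × C u v ≢ 𝟎) → NormalForm C W
  viaPair (v , (Wv , v≢u) , Cuv≢0) = normalForm-≗ normalForm C G HG ∣W″∣≤k C⋆W≗G⋆W″ W∈
    where
    pair = matrixSystem-⋆-pair C H v≢u (diagonal≡0 u Wu) (diagonal≡0 v Wv) Cuv≢0
    G = proj₁ pair
    HG = proj₁ (proj₂ pair)
    W″ = W⁻ [ v ]≔ false
    W⁻v : lookup W⁻ v ≡ true
    W⁻v = trans (lookup∘update′ v≢u W false) Wv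
    ∣W″∣≤k : ∣ W″ ∣ ≤ k
    ∣W″∣≤k = ≤-trans (n≤1+n ∣ W″ ∣) (s≤s⁻¹ (≤-trans (s≤s (∣[]≔false∣< W⁻ v W⁻v)) (≤-trans (∣[]≔false∣< W u Wu) ∣W∣≤1+k)))
    C⋆W≗G⋆W″ : matrixSystem C ⋆ W ≗ matrixSystem G ⋆ W″
    C⋆W≗G⋆W″ = begin
      matrixSystem C ⋆ W                                   ≈⟨ ⋆-congʳ (matrixSystem C) ([]≔false-△-⁅⁆ W u Wu) ⟨
      matrixSystem C ⋆ (W⁻ △ ⁅ u ⁆)                        ≈⟨ ⋆-congʳ (matrixSystem C) (cong (_△ ⁅ u ⁆) ([]≔false-△-⁅⁆ W⁻ v W⁻v)) ⟨
      matrixSystem C ⋆ ((W″ △ ⁅ v ⁆) △ ⁅ u ⁆)              ≈⟨ ⋆-⋆ (matrixSystem C) ⁅ u ⁆ (W″ △ ⁅ v ⁆) ⟨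
      (matrixSystem C ⋆ ⁅ u ⁆) ⋆ (W″ △ ⁅ v ⁆)              ≈⟨ ⋆-⋆ (matrixSystem C ⋆ ⁅ u ⁆) ⁅ v ⁆ W″ ⟨
      ((matrixSystem C ⋆ ⁅ u ⁆) ⋆ ⁅ v ⁆) ⋆ W″              ≈⟨ ⋆-congˡ W″ (proj₂ (proj₂ pair)) ⟩
      matrixSystem G ⋆ W″                                  ∎
      where open ≗-Reasoning

-- Twisting M_C by a feasible set W: repeatedly pivot on an element of W with
-- diagonal entry 1, or, if there is none, on a pair as in matrixSystem-⋆-pair.
normalForm : ∀ {n} k → NormalFormsUpTo n k
normalForm-member : ∀ {n} k (C : Mat n) {W} → InvSymmetric C → ∣ W ∣ ≤ k → W ∈ₛ matrixSystem C →
  ∀ u → lookup W u ≡ true → NormalForm C W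

normalForm k {W} C H ∣W∣≤k W∈ with any? (λ u → lookup W u Bool.≟ true)
... | yes (u , Wu) = normalForm-member k C H ∣W∣≤k W∈ u Wu
... | no ∄u = C , H , λ Y → trans (⋆-congʳ (matrixSystem C) W≡⊥ Y) (⋆-⊥ (matrixSystem C) Y)
  where
  W≡⊥ : W ≡ ⊥
  W≡⊥ = Empty-unique λ { (u , u∈W) → ∄u (u , []=⇒lookup u∈W) }

normalForm-member zero C {W} H ∣W∣≤0 W∈ u Wu = contradiction (<-≤-trans (∣[]≔false∣< W u Wu) ∣W∣≤0) n≮0
normalForm-member (suc k) C {W} H ∣W∣≤1+k W∈ u Wu with any? (λ w → (lookup W w Bool.≟ true) ×-dec (C w w ≟F 𝟏))
... | yes (w , Ww , Cww≡1) = normalForm-pivot (normalForm k) C H ∣W∣≤1+k W∈ w Ww Cww≡1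
... | no ∄w = normalForm-pair (normalForm k) C H ∣W∣≤1+k W∈ u Wu diagonal≡0
  where
  diagonal≡0 : ∀ w → lookup W w ≡ true → C w w ≡ 𝟎
  diagonal≡0 w Ww with binary⇒0⊎1 (C w w) (H w w)
  ... | inj₁ Cww≡0 = Cww≡0
  ... | inj₂ Cww≡1 = ⊥-elim (∄w (w , Ww , Cww≡1))

exchange-∅ : ∀ {n} (D : Mat n) {Y u} → InvSymmetric D → Y ∈ₛ matrixSystem D → lookup Y u ≡ true →
  ⁅ u ⁆ ∈ₛ matrixSystem D ⊎ ∃ λ v → lookup Y v ≡ true × v ≢ u × (⁅ u ⁆ ∪ ⁅ v ⁆) ∈ₛ matrixSystem D
exchange-∅ D {Y} {u} H Y∈ Yu with binary⇒0⊎1 (D u u) (H u u)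
... | inj₂ Duu≡1 = inj₁ (matrixSystem-⁅⁆ D u Duu≡1)
... | inj₁ Duu≡0 with offDiagonal-nonzero D Y u Duu≡0 Yu Y∈
...   | v , (Yv , v≢u) , Duv≢0 = inj₂ (v , Yv , v≢u , matrixSystem-pair D H (v≢u ∘ sym) Duu≡0 Duv≢0)

-- After twisting by a feasible set X, the exchange axiom at X becomes the
-- exchange axiom at ∅ for some M_D.
invRepresentable⇒deltaMatroid : ∀ {n} {M : SetSystem n} → InvRepresentable M → IsDeltaMatroid M
invRepresentable⇒deltaMatroid {M = M} (C , H , W , M≗) = (W , W∈) , exchange
  where
  W∈ : W ∈ₛ M
  W∈ = trans (M≗ W) (trans (cong (matrixSystem C) (△-self W)) (matrixSystem-∅ C))
  exchange : ∀ X Y → X ∈ₛ M → Y ∈ₛ M → ∀ u → lookup (X △ Y) u ≡ true →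
    (X △ ⁅ u ⁆) ∈ₛ M ⊎ ∃ λ v → lookup (X △ Y) v ≡ true × v ≢ u × (X △ (⁅ u ⁆ ∪ ⁅ v ⁆)) ∈ₛ M
  exchange X Y X∈ Y∈ u X△Yu = atX (normalForm ∣ X △ W ∣ C H ≤-refl (trans (sym (M≗ X)) X∈))
    where
    Y△X≡X△Y : ∀ v → lookup (Y △ X) v ≡ lookup (X △ Y) v
    Y△X≡X△Y v = cong (λ S → lookup S v) (△-comm Y X)
    atX : NormalForm C (X △ W) →
      (X △ ⁅ u ⁆) ∈ₛ M ⊎ ∃ λ v → lookup (X △ Y) v ≡ true × v ≢ u × (X △ (⁅ u ⁆ ∪ ⁅ v ⁆)) ∈ₛ M
    atX (D , HD , C⋆X△W≗D) = Sum.map (trans (M≡D ⁅ u ⁆))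
      (λ { (v , Y△Xv , v≢u , uv∈) → v , trans (sym (Y△X≡X△Y v)) Y△Xv , v≢u , trans (M≡D (⁅ u ⁆ ∪ ⁅ v ⁆)) uv∈ })
      (exchange-∅ D HD (trans (sym (M≗D⋆X Y)) Y∈) (trans (Y△X≡X△Y u) X△Yu))
      where
      M≗D⋆X : M ≗ matrixSystem D ⋆ X
      M≗D⋆X Z = trans (M≗ Z) (trans (cong (matrixSystem C) (sym (△-cancel-middle Z X W))) (C⋆X△W≗D (Z △ X)))
      M≡D : ∀ P → M (X △ P) ≡ matrixSystem D P
      M≡D P = trans (M≗D⋆X (X △ P)) (cong (matrixSystem D) (△-cancelˡ X P))

theorem6 : (n : ℕ) (M : SetSystem n) → IsDeltaMatroid M → InvRepresentable M →
    (φ : List (Op n)) →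
    IsDeltaMatroid (applySeq M φ) × InvRepresentable (applySeq M φ)
theorem6 n M _ M-rep φ = invRepresentable⇒deltaMatroid Mφ-rep , Mφ-rep
  where
  Mφ-rep = invRepresentable-applySeq M-rep φ
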